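{- Let $(\Phi,h)$ be a weighted gain graph and $O$ a linear ordering of its edge set $E$. The forest expansion $$F_{(\Phi,h),O}(\mathbf{u},y)=\sum_{F}y^{\epsilon(F)}\prod_{W\in\pi(F)}u_{h/F(W)},$$ summed over all spanning forests $F$ of $\Phi$, is independent of $O$; indeed $F_{(\Phi,h),O}(\mathbf{u},y)=Q_{(\Phi,h)}(\mathbf{u},y-1,0)$.
   Context: A graph $\Gamma=(V,E)$ is finite, $V=\{v_1,\dots,v_n\}$, multiple edges allowed; an edge is a link, loop, half edge (one endpoint) or loose edge (no endpoint). A gain graph $\Phi$ has a lattice-ordered gain group $\mathfrak{G}$ and gains $\varphi(e)$ on links and loops with $\varphi(e^{ -1})=\varphi(e)^{ -1}$; the gain of a walk is the product of its gains. A circle is a connected 2-regular subgraph without half edges; an edge set is balanced if it has no half edges and all its circles have gain $1$. In this context a loose edge is treated as a loop of gain $1$ (a balanced loop) and a half edge as a loop of gain $\ne1$ (an unbalanced loop). For $S\subseteq E$: $c(S)$, $\pi(S)$ are the number and the vertex-set partition of connected components of $(V,S)$ (isolated vertices count); $b(S)$ counts balanced components and $\pi_b(S)$ lists their vertex sets. For a balanced component with vertex set $W$ and $v\in W$, $\eta_S(v)=\bigvee_{w\in W}\varphi(S_{vw})$ where $S_{vw}$ is any path in $S$ from $v$ to $w$. A weighted gain graph has an abelian semigroup $\mathfrak{W}$ (additive) with right $\mathfrak{G}$-action by automorphisms and weights $h_i=h(v_i)\in\mathfrak{W}$; for $W\in\pi_b(S)$, $h/S(W)=\sum_{v_i\in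 W}h_i\eta_S(v_i)$. The total dichromatic polynomial, with indeterminates $u_k$ ($k\in\mathfrak{W}$), $v$, $z$, is $Q_{(\Phi,h)}(\mathbf{u},v,z)=\sum_{S\subseteq E}v^{|S|-n+b(S)}z^{c(S)-b(S)}\prod_{W\in\pi_b(S)}u_{h/S(W)}$ (with $z^0=1$ when $z=0$). A spanning forest is an edge set containing no circle (hence balanced, with no loops, half or loose edges). For a spanning forest $F$, $\mathrm{clos}(F)=F\cup\{e\notin F: F\cup\{e\}\text{ contains a balanced circle}\}$; for $e\in\mathrm{clos}(F)\setminus F$ the fundamental circle $C_F(e)$ is the unique circle in $F\cup\{e\}$; $e$ is externally active if $e\in\mathrm{clos}(F)\setminus F$ and $e$ is the largest element of $C_F(e)$ in $O$; $\epsilon(F)$ is the number of externally active edges. -}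

module Defs where

open import Level using (0ℓ)
open import Data.Nat using (ℕ; zero; suc; _∸_; _≤_) renaming (_+_ to _+ℕ_)
open import Data.Fin using (Fin; toℕ)
open import Data.Fin.Subset using (Subset; _∈_; _∉_; _∪_; ⁅_⁆; ∣_∣; inside; outside)
open import Data.List using (List; []; _∷_; _++_; map; foldr; filter; length; allFin)
open import Data.List.Relation.Unary.Unique.Propositional using (Unique)
open import Data.List.Relation.Unary.Any using (Any)
open import Data.Vec using (Vec; []; _∷_)
open import Data.Maybe using (Maybe; just; nothing)
open import Data.Product using (Σ; _×_; _,_; proj₁)
open import Data.Sum using (_⊎_)
open import Data.Empty using (⊥)
open import Relation.Nullary using (¬_; Dec; yes; no)
open import Relation.Binary using (Rel; IsStrictTotalOrder)
open import Relation.Binary.PropositionalEquality using (_≡_; _≢_)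
open import Algebra.Core using (Op₁; Op₂)
open import Algebra.Structures using (IsGroup; IsCommutativeSemigroup)
open import Algebra.Lattice.Structures using (IsLattice)
open import Algebra.Bundles using (CommutativeRing)
open import Axiom.ExcludedMiddle using (ExcludedMiddle)

record LatticeOrderedGroup : Set₁ where
  infixl 7 _∙_
  infixr 6 _∨_
  field
    Carrier   : Set
    _∙_       : Op₂ Carrier
    ε         : Carrier
    _⁻¹       : Op₁ Carrier
    _∨_ _∧_   : Op₂ Carrier
    isGroup   : IsGroup _≡_ _∙_ ε _⁻¹
    isLattice : IsLattice _≡_ _∨_ _∧_

  _≼_ : Carrier → Carrier → Set
  x ≼ y = (x ∨ y) ≡ y

  field
    translation-invariant : ∀ a b x y → x ≼ y → (a ∙ x ∙ b) ≼ (a ∙ y ∙ b)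

record WeightSemigroup (𝔊 : LatticeOrderedGroup) : Set₁ where
  open LatticeOrderedGroup 𝔊 renaming (Carrier to G)
  infixl 6 _+_
  infixl 7 _·_
  field
    Carrier   : Set
    _+_       : Op₂ Carrier
    isCommutativeSemigroup : IsCommutativeSemigroup _≡_ _+_
    _·_       : Carrier → G → Carrier
    ·-identity : ∀ w → w · ε ≡ w
    ·-assoc    : ∀ w g g′ → (w · g) · g′ ≡ w · (g ∙ g′)
    ·-+-hom    : ∀ w w′ g → (w + w′) · g ≡ (w · g) + (w′ · g)

-- Edges of a graph on vertex set Fin n with gains in G.
-- ordinary a b g : a link (a ≢ b) or a loop (a ≡ b) from a to b with gain g
--                  (traversed from b to a it has gain g ⁻¹);
-- half a         : a half edge with endpoint a;
-- loose          : a loose edge.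

data Edge (n : ℕ) (G : Set) : Set where
  ordinary : Fin n → Fin n → G → Edge n G
  half     : Fin n → Edge n G
  loose    : Edge n G

record GainGraph (𝔊 : LatticeOrderedGroup) : Set₁ where
  field
    n m  : ℕ
    edge : Fin m → Edge n (LatticeOrderedGroup.Carrier 𝔊)

record WeightedGainGraph (𝔊 : LatticeOrderedGroup) (𝔚 : WeightSemigroup 𝔊) : Set₁ where
  field
    Φ : GainGraph 𝔊
  open GainGraph Φ public
  field
    h : Fin n → WeightSemigroup.Carrier 𝔚

allSubsets : (m : ℕ) → List (Subset m)
allSubsets zero    = [] ∷ []
allSubsets (suc m) = map (outside ∷_) (allSubsets m) ++ map (inside ∷_) (allSubsets m)

combineM : {A : Set} → Op₂ A → Maybe A → Maybe A → Maybe A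
combineM _ nothing y = y
combineM _ (just x) nothing = just x
combineM f (just x) (just y) = just (f x y)

foldM : {A : Set} → Op₂ A → List (Maybe A) → Maybe A
foldM f = foldr (combineM f) nothing

fromMaybe : {A : Set} → A → Maybe A → A
fromMaybe d nothing  = d
fromMaybe _ (just x) = x

countBy : ExcludedMiddle 0ℓ → {A : Set} → (A → Set) → List A → ℕ
countBy lem P xs = length (filter (λ x → lem {P x}) xs)

filterBy : ExcludedMiddle 0ℓ → {A : Set} → (A → Set) → List A → List A
filterBy lem P xs = filter (λ x → lem {P x}) xs

module GainGraphNotions {𝔊 : LatticeOrderedGroup} {𝔚 : WeightSemigroup 𝔊}
                        (lem : ExcludedMiddle 0ℓ)
                        (ΦH : WeightedGainGraph 𝔊 𝔚) where
  open LatticeOrderedGroup 𝔊 renaming (Carrier to G)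
  open WeightSemigroup 𝔚 using (_+_; _·_) renaming (Carrier to Wt)
  open WeightedGainGraph ΦH

  data Walk (S : Subset m) : Fin n → Fin n → G → Set where
    []   : ∀ {v} → Walk S v v ε
    fwd  : ∀ {a b w g g′} (e : Fin m) → e ∈ S → edge e ≡ ordinary a b g →
           Walk S b w g′ → Walk S a w (g ∙ g′)
    bwd  : ∀ {a b w g g′} (e : Fin m) → e ∈ S → edge e ≡ ordinary a b g →
           Walk S a w g′ → Walk S b w (g ⁻¹ ∙ g′)

  vertices : ∀ {S v w g} → Walk S v w g → List (Fin n)
  vertices {v = v} []         = v ∷ []
  vertices {v = v} (fwd _ _ _ p) = v ∷ vertices p
  vertices {v = v} (bwd _ _ _ p) = v ∷ vertices p

  edges : ∀ {S v w g} → Walk S v w g → List (Fin m)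
  edges []            = []
  edges (fwd e _ _ p) = e ∷ edges p
  edges (bwd e _ _ p) = e ∷ edges p

  tail : List (Fin n) → List (Fin n)
  tail []       = []
  tail (_ ∷ xs) = xs

  IsPath : ∀ {S v w g} → Walk S v w g → Set
  IsPath p = Unique (vertices p)

  IsCircleWalk : ∀ {S v g} → Walk S v v g → Set
  IsCircleWalk p = (edges p ≢ []) × Unique (edges p) × Unique (tail (vertices p))

  -- A loose edge is a
  -- circle (a loop of gain ε).  (Half edges, i.e. unbalanced loops, are
  -- handled separately in Balanced / SpanningForest below.)
  data Circle (S : Subset m) : List (Fin m) → G → Set where
    walkCircle  : ∀ {v g} (p : Walk S v v g) → IsCircleWalk p → Circle S (edges p) g
    looseCircle : ∀ e → e ∈ S → edge e ≡ loose → Circle S (e ∷ []) ε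

  Connected : Subset m → Fin n → Fin n → Set
  Connected S v w = Σ G λ g → Walk S v w g

  -- r is the representative (least vertex) of its connected component
  IsRep : Subset m → Fin n → Set
  IsRep S r = ∀ w → Connected S r w → toℕ r ≤ toℕ w

  reps : Subset m → List (Fin n)
  reps S = filterBy lem (IsRep S) (allFin n)

  BalancedComp : Subset m → Fin n → Set
  BalancedComp S r =
    (∀ e a → e ∈ S → edge e ≡ half a → ¬ Connected S r a) ×
    (∀ v g (p : Walk S v v g) → IsCircleWalk p → Connected S r v → g ≡ ε)

  balancedReps : Subset m → List (Fin n)
  balancedReps S = filterBy lem (BalancedComp S) (reps S)

  c b : Subset m → ℕ
  c S = length (reps S)
  b S = length (balancedReps S)

  pathGain : Subset m → Fin n → Fin n → Maybe G
  pathGain S v w with lem {Σ G λ g → Σ (Walk S v w g) IsPath}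
  ... | yes (g , _) = just g
  ... | no _        = nothing

  η : Subset m → Fin n → G
  η S v = fromMaybe ε (foldM _∨_ (map (pathGain S v) (allFin n)))

  -- h/S(W) for the component W with representative r:
  -- Σ_{v ∈ W} h(v) η_S(v)   (W is nonempty, the default is never used)
  h/ : Subset m → Fin n → Wt
  h/ S r = fromMaybe (h r)
    (foldM _+_ (map (λ v → just (h v · η S v)) (filterBy lem (Connected S r) (allFin n))))

  SpanningForest : Subset m → Set
  SpanningForest F = (∀ e a → e ∈ F → edge e ≢ half a) ×
                     (∀ es g → ¬ Circle F es g)

  ExternallyActive : (Fin m → Fin m → Set) → Subset m → Fin m → Set
  ExternallyActive _<O_ F e =
    e ∉ F × Σ (List (Fin m)) λ es → Circle (F ∪ ⁅ e ⁆) es ε ×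
            (∀ f → Any (f ≡_) es → (f ≡ e) ⊎ (f <O e))

  εF : (Fin m → Fin m → Set) → Subset m → ℕ
  εF _<O_ F = countBy lem (ExternallyActive _<O_ F) (allFin m)

-- Polynomial evaluations in an arbitrary commutative ring R.
-- (A polynomial identity over ℤ in the indeterminates u_k, y holds iff it
-- holds under every evaluation in every commutative ring.)

module _ {c ℓ} (R : CommutativeRing c ℓ) where
  open CommutativeRing R

  pow : Carrier → ℕ → Carrier
  pow x zero    = 1#
  pow x (suc k) = x * pow x k

  sumR : List Carrier → Carrier
  sumR = foldr _+_ 0#

  prodR : List Carrier → Carrier
  prodR = foldr _*_ 1#

totalDichromatic : ∀ {c ℓ} {𝔊 : LatticeOrderedGroup} {𝔚 : WeightSemigroup 𝔊} →
  ExcludedMiddle 0ℓ → WeightedGainGraph 𝔊 𝔚 → (R : CommutativeRing c ℓ) →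
  (WeightSemigroup.Carrier 𝔚 → CommutativeRing.Carrier R) →
  CommutativeRing.Carrier R → CommutativeRing.Carrier R → CommutativeRing.Carrier R
totalDichromatic lem ΦH R u v z =
  sumR R (map (λ S → pow R v ((∣ S ∣ +ℕ b S) ∸ n) * pow R z (c S ∸ b S) *
                     prodR R (map (λ W → u (h/ S W)) (balancedReps S)))
              (allSubsets m))
  where
    open CommutativeRing R using (_*_)
    open WeightedGainGraph ΦH using (n; m)
    open GainGraphNotions lem ΦH

forestExpansion : ∀ {c ℓ} {𝔊 : LatticeOrderedGroup} {𝔚 : WeightSemigroup 𝔊} →
  ExcludedMiddle 0ℓ → (ΦH : WeightedGainGraph 𝔊 𝔚) →
  (Fin (WeightedGainGraph.m ΦH) → Fin (WeightedGainGraph.m ΦH) → Set) →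
  (R : CommutativeRing c ℓ) →
  (WeightSemigroup.Carrier 𝔚 → CommutativeRing.Carrier R) →
  CommutativeRing.Carrier R → CommutativeRing.Carrier R
forestExpansion lem ΦH _<O_ R u y =
  sumR R (map (λ F → pow R y (εF _<O_ F) * prodR R (map (λ W → u (h/ F W)) (reps F)))
              (filterBy lem SpanningForest (allSubsets m)))
  where
    open CommutativeRing R using (_*_)
    open WeightedGainGraph ΦH using (m)
    open GainGraphNotions lem ΦH

-- Put x = y - 1. By the binomial theorem y ^ ε(F) = (1 + x) ^ ε(F) is the sum of x ^ (|S| - |F|)
-- over the edge sets S with F ⊆ S ⊆ F ∪ EA(F), EA(F) the externally active edges. Exchanging the
-- two sums turns the forest expansion into a sum over all S of the spanning forests whose interval
-- contains S. Such a forest exists iff every component of S is balanced: then it is the Kruskal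
-- forest of S, obtained by deleting each edge that is the largest edge of some circle of S, and it
-- is unique, as two candidates cannot differ at an O-least edge. Relative to that forest F, each
-- edge of S is parallel to a walk in F of the same gain, so S and F have the same components, the
-- same η and the same weights h/, and |F| + c(F) = n makes x ^ (|S| - |F|) the factor
-- x ^ (|S| + b(S) - n) of Q(u, x, 0). If no such forest exists, c(S) > b(S) and the term of S in
-- Q(u, x, 0) vanishes. The result no longer mentions O, so it is independent of O.

module Submission where

open import Defs
open import Level using (0ℓ)
open import Data.Nat using (zero; suc; _∸_; _<_) renaming (_+_ to _+ℕ_)
import Data.Nat.Properties as ℕₚ
open import Data.Nat.Properties
  using (≤-refl; ≤-trans; ≮⇒≥; ≤-antisym; <-cmp; <⇒≱; <⇒≤; +-suc; suc-injective;
         +-∸-assoc; [m+n]∸[m+o]≡n∸o; n∸n≡0; m∸n≡0⇒m≤n)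
open import Data.Fin as Fin using (Fin; toℕ; _≟_)
open import Data.Fin.Properties using (toℕ-injective)
open import Data.Fin.Induction using (<-wellFounded; spo-wellFounded)
open import Data.Fin.Subset
  using (Subset; _∈_; _∉_; _∪_; ⁅_⁆; ∣_∣; inside; outside; _⊆_) renaming (⊥ to ∅; _-_ to _∖_)
open import Data.Fin.Subset.Properties
  using (x∈p∪q⁻; x∈⁅x⁆; x∈⁅y⁆⇒x≡y; ∉⊥; p─⊥≡p; p─q⊆p; x∈p∧x≢y⇒x∈p-y; p⊆q⇒∣p∣≤∣q∣; p⊆p∪q; q⊆p∪q;
         drop-∷-⊆; drop-there; s⊆s; out⊆; ⊆-antisym; nonempty?; Empty-unique; ∣⊥∣≡0)
open import Data.List using (List; []; _∷_; _++_; map; length; allFin; tabulate)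
open import Data.List.Properties using (filter-complete; filter-all; length-filter; length-tabulate; map-cong)
open import Data.List.Membership.Propositional using () renaming (_∈_ to _∈ₗ_)
open import Data.List.Membership.Propositional.Properties using (∈-allFin; ∈-filter⁺; ∈-filter⁻)
open import Data.List.Relation.Unary.Any using (here; there)
open import Data.List.Relation.Unary.All as All using ([])
open import Data.List.Relation.Unary.All.Properties using (¬Any⇒All¬)
open import Data.List.Relation.Unary.AllPairs using ([]; _∷_)
open import Data.List.Relation.Unary.Unique.Propositional using (Unique)
open import Data.List.Relation.Unary.Unique.Propositional.Properties using (allFin⁺)
open import Data.Maybe using (just)
open import Data.Product as Product using (Σ; _×_; _,_; proj₁; proj₂)
open import Data.Sum as Sum using (_⊎_; inj₁; inj₂)
open import Data.Vec using (_∷_) renaming ([] to []ᵛ; here to hereᵛ; there to thereᵛ)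
open import Data.Empty using (⊥-elim)
open import Function using (_∘_; id; flip; _⇔_; mk⇔; Equivalence)
open import Induction.WellFounded as WF using (WellFounded; Acc; acc)
open import Relation.Nullary using (¬_; Dec; yes; no; contradiction)
open import Relation.Binary using (IsStrictTotalOrder; tri<; tri≈; tri>)
import Relation.Binary.Construct.Flip.EqAndOrd as Flip
open import Relation.Binary.PropositionalEquality
  using (_≡_; _≢_; refl; sym; trans; cong; cong₂; subst; module ≡-Reasoning)
open import Algebra.Bundles using (CommutativeRing; Group)
open import Algebra.Structures using (IsGroup)
open import Axiom.ExcludedMiddle using (ExcludedMiddle)

x∈p∪⁅y⁆⁻ : ∀ {k} {p : Subset k} {x y} → x ∈ p ∪ ⁅ y ⁆ → x ∈ p ⊎ x ≡ y
x∈p∪⁅y⁆⁻ {p = p} {y = y} x∈ = Sum.map₂ (x∈⁅y⁆⇒x≡y y) (x∈p∪q⁻ p ⁅ y ⁆ x∈)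

x∉p∖x : ∀ {k} (p : Subset k) x → x ∉ p ∖ x
x∉p∖x (_ ∷ p) (Fin.suc x) (thereᵛ x∈) = x∉p∖x p x x∈

∣p∖x∣+1≡∣p∣ : ∀ {k} (p : Subset k) {x} → x ∈ p → suc ∣ p ∖ x ∣ ≡ ∣ p ∣
∣p∖x∣+1≡∣p∣ (inside ∷ p) hereᵛ = cong (suc ∘ ∣_∣) (p─⊥≡p p)
∣p∖x∣+1≡∣p∣ (inside ∷ p) (thereᵛ x∈p) = cong suc (∣p∖x∣+1≡∣p∣ p x∈p)
∣p∖x∣+1≡∣p∣ (outside ∷ p) (thereᵛ x∈p) = ∣p∖x∣+1≡∣p∣ p x∈p

module Classical (lem : ExcludedMiddle 0ℓ) where

  module _ {A : Set} where

    filterBy-cong : {P Q : A → Set} (xs : List A) →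
      (∀ {x} → x ∈ₗ xs → P x → Q x) → (∀ {x} → x ∈ₗ xs → Q x → P x) →
      filterBy lem P xs ≡ filterBy lem Q xs
    filterBy-cong [] P⇒Q Q⇒P = refl
    filterBy-cong {P} {Q} (x ∷ xs) P⇒Q Q⇒P with lem {P x} | lem {Q x}
    ... | yes _  | yes _  = cong (x ∷_) (filterBy-cong xs (P⇒Q ∘ there) (Q⇒P ∘ there))
    ... | no _   | no _   = filterBy-cong xs (P⇒Q ∘ there) (Q⇒P ∘ there)
    ... | yes Px | no ¬Qx = contradiction (P⇒Q (here refl) Px) ¬Qx
    ... | no ¬Px | yes Qx = contradiction (Q⇒P (here refl) Qx) ¬Px

    length-filterBy≡length⇒P : (P : A → Set) (xs : List A) →
      length (filterBy lem P xs) ≡ length xs → ∀ {x} → x ∈ₗ xs → P x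
    length-filterBy≡length⇒P P xs eq x∈xs =
      proj₂ (∈-filter⁻ P? {xs = xs} (subst (_ ∈ₗ_) (sym (filter-complete P? eq)) x∈xs))
      where
        P? : ∀ x → Dec (P x)
        P? x = lem

    length-filterBy-extend : (P Q : A → Set) {r : A} (xs : List A) → Unique xs → r ∈ₗ xs →
      ¬ P r → Q r → (∀ {x} → P x → Q x) → (∀ {x} → Q x → P x ⊎ x ≡ r) →
      length (filterBy lem Q xs) ≡ suc (length (filterBy lem P xs))
    length-filterBy-extend P Q (x ∷ xs) (x∉xs ∷ _) (here refl) ¬Pr Qr P⇒Q Q⇒P⊎r
      with lem {Q x} | lem {P x}
    ... | no ¬Qx | _     = contradiction Qr ¬Qx
    ... | yes _  | yes Px = contradiction Px ¬Pr
    ... | yes _  | no _  = cong (suc ∘ length) (filterBy-cong xs Q⇒P (λ _ → P⇒Q))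
      where
        Q⇒P : ∀ {y} → y ∈ₗ xs → Q y → P y
        Q⇒P y∈xs Qy = Sum.[ id , (λ y≡x → contradiction (sym y≡x) (All.lookup x∉xs y∈xs)) ] (Q⇒P⊎r Qy)
    length-filterBy-extend P Q (x ∷ xs) (x∉xs ∷ u) (there r∈xs) ¬Pr Qr P⇒Q Q⇒P⊎r
      with lem {Q x} | lem {P x}
    ... | yes _  | yes _  = cong suc (length-filterBy-extend P Q xs u r∈xs ¬Pr Qr P⇒Q Q⇒P⊎r)
    ... | no _   | no _   = length-filterBy-extend P Q xs u r∈xs ¬Pr Qr P⇒Q Q⇒P⊎r
    ... | no ¬Qx | yes Px = contradiction (P⇒Q Px) ¬Qx
    ... | yes Qx | no ¬Px =
      Sum.[ (λ Px → contradiction Px ¬Px) , (λ x≡r → contradiction x≡r (All.lookup x∉xs r∈xs)) ] (Q⇒P⊎r Qx)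

  countBy-tabulate : ∀ {A : Set} {k} (P : A → Set) (f : Fin k → A) →
    countBy lem P (tabulate f) ≡ countBy lem (P ∘ f) (allFin k)
  countBy-tabulate {k = zero} P f = refl
  countBy-tabulate {k = suc k} P f with lem {P (f Fin.zero)}
  ... | yes _ = cong suc (trans (countBy-tabulate P (f ∘ Fin.suc))
                                (sym (countBy-tabulate (P ∘ f) Fin.suc)))
  ... | no _ = trans (countBy-tabulate P (f ∘ Fin.suc)) (sym (countBy-tabulate (P ∘ f) Fin.suc))

  module _ {A : Set} {_<_ : A → A → Set} (wf : WellFounded _<_) (P : A → Set) where

    minimal : ∀ {x} → P x → Σ A λ m → P m × (∀ {y} → P y → ¬ y < m)
    minimal {x} = go (wf x)
      where
        go : ∀ {x} → Acc _<_ x → P x → Σ A λ m → P m × (∀ {y} → P y → ¬ y < m)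
        go {x} (acc rs) Px with lem {Σ A λ y → P y × y < x}
        ... | yes (y , Py , y<x) = go (rs y<x) Py
        ... | no ∄ = x , Px , λ Py y<x → ∄ (_ , Py , y<x)

  toSubset : ∀ {k} → (Fin k → Set) → Subset k
  toSubset {zero} P = []ᵛ
  toSubset {suc k} P with lem {P Fin.zero}
  ... | yes _ = inside ∷ toSubset (P ∘ Fin.suc)
  ... | no _  = outside ∷ toSubset (P ∘ Fin.suc)

  ∈-toSubset⁻ : ∀ {k} (P : Fin k → Set) {e} → e ∈ toSubset P → P e
  ∈-toSubset⁻ {suc k} P x∈ with lem {P Fin.zero}
  ∈-toSubset⁻ {suc k} P hereᵛ       | yes P0 = P0
  ∈-toSubset⁻ {suc k} P (thereᵛ x∈) | yes _ = ∈-toSubset⁻ (P ∘ Fin.suc) x∈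
  ∈-toSubset⁻ {suc k} P (thereᵛ x∈) | no _  = ∈-toSubset⁻ (P ∘ Fin.suc) x∈

  ∈-toSubset⁺ : ∀ {k} (P : Fin k → Set) {e} → P e → e ∈ toSubset P
  ∈-toSubset⁺ {suc k} P {e} Pe with lem {P Fin.zero}
  ∈-toSubset⁺ {suc k} P {Fin.zero}  Pe | yes _  = hereᵛ
  ∈-toSubset⁺ {suc k} P {Fin.suc e} Pe | yes _  = thereᵛ (∈-toSubset⁺ (P ∘ Fin.suc) Pe)
  ∈-toSubset⁺ {suc k} P {Fin.zero}  Pe | no ¬P0 = contradiction Pe ¬P0
  ∈-toSubset⁺ {suc k} P {Fin.suc e} Pe | no _   = thereᵛ (∈-toSubset⁺ (P ∘ Fin.suc) Pe)

module Sums {c ℓ} (R : CommutativeRing c ℓ) where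
  open CommutativeRing R renaming (refl to ≈-refl; sym to ≈-sym; trans to ≈-trans)
  open import Algebra.Properties.CommutativeSemigroup +-commutativeSemigroup using (interchange)
  open import Relation.Binary.Reasoning.Setoid setoid

  sumOver : {A : Set} → List A → (A → Carrier) → Carrier
  sumOver xs f = sumR R (map f xs)

  when : {P : Set} → Dec P → Carrier → Carrier
  when (yes _) a = a
  when (no _)  a = 0#

  sumOver-cong : {A : Set} (xs : List A) {f g : A → Carrier} →
    (∀ {x} → x ∈ₗ xs → f x ≈ g x) → sumOver xs f ≈ sumOver xs g
  sumOver-cong []       f≈g = ≈-refl
  sumOver-cong (x ∷ xs) f≈g = +-cong (f≈g (here refl)) (sumOver-cong xs (f≈g ∘ there))

  sumOver-zero : {A : Set} (xs : List A) {f : A → Carrier} →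
    (∀ {x} → x ∈ₗ xs → f x ≈ 0#) → sumOver xs f ≈ 0#
  sumOver-zero []       f≈0 = ≈-refl
  sumOver-zero (x ∷ xs) f≈0 =
    ≈-trans (+-cong (f≈0 (here refl)) (sumOver-zero xs (f≈0 ∘ there))) (+-identityˡ 0#)

  sumOver-++ : {A : Set} (xs ys : List A) (f : A → Carrier) →
    sumOver (xs ++ ys) f ≈ sumOver xs f + sumOver ys f
  sumOver-++ []       ys f = ≈-sym (+-identityˡ _)
  sumOver-++ (x ∷ xs) ys f = ≈-trans (+-congˡ (sumOver-++ xs ys f)) (≈-sym (+-assoc _ _ _))

  sumOver-map : {A : Set} {B : Set} (g : B → A) (xs : List B) (f : A → Carrier) →
    sumOver (map g xs) f ≡ sumOver xs (f ∘ g)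
  sumOver-map g []       f = refl
  sumOver-map g (x ∷ xs) f = cong (f (g x) +_) (sumOver-map g xs f)

  sumOver-+ : {A : Set} (xs : List A) (f g : A → Carrier) →
    sumOver xs (λ x → f x + g x) ≈ sumOver xs f + sumOver xs g
  sumOver-+ []       f g = ≈-sym (+-identityˡ 0#)
  sumOver-+ (x ∷ xs) f g = ≈-trans (+-congˡ (sumOver-+ xs f g)) (interchange _ _ _ _)

  sumOver-*ˡ : {A : Set} (xs : List A) (f : A → Carrier) (a : Carrier) →
    a * sumOver xs f ≈ sumOver xs (λ x → a * f x)
  sumOver-*ˡ []       f a = zeroʳ a
  sumOver-*ˡ (x ∷ xs) f a = ≈-trans (distribˡ a (f x) (sumOver xs f)) (+-congˡ (sumOver-*ˡ xs f a))

  sumOver-*ʳ : {A : Set} (xs : List A) (f : A → Carrier) (a : Carrier) →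
    sumOver xs f * a ≈ sumOver xs (λ x → f x * a)
  sumOver-*ʳ []       f a = zeroˡ a
  sumOver-*ʳ (x ∷ xs) f a = ≈-trans (distribʳ a (f x) (sumOver xs f)) (+-congˡ (sumOver-*ʳ xs f a))

  sumOver-swap : {A : Set} {B : Set} (xs : List A) (ys : List B) (f : A → B → Carrier) →
    sumOver xs (λ x → sumOver ys (f x)) ≈ sumOver ys (λ y → sumOver xs (λ x → f x y))
  sumOver-swap []       ys f = ≈-sym (sumOver-zero ys (λ _ → ≈-refl))
  sumOver-swap (x ∷ xs) ys f =
    ≈-trans (+-congˡ (sumOver-swap xs ys f)) (≈-sym (sumOver-+ ys (f x) (λ y → sumOver xs (λ x → f x y))))

  when-yes : {P : Set} (d : Dec P) → P → ∀ a → when d a ≈ a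
  when-yes (yes _) _ a = ≈-refl
  when-yes (no ¬p) p a = contradiction p ¬p

  when-no : {P : Set} (d : Dec P) → ¬ P → ∀ a → when d a ≈ 0#
  when-no (yes p) ¬p a = contradiction p ¬p
  when-no (no _)  _  a = ≈-refl

  when-cong : {P Q : Set} (d : Dec P) (d′ : Dec Q) → P ⇔ Q → ∀ {a b} → a ≈ b → when d a ≈ when d′ b
  when-cong (yes _) (yes _) _   a≈b = a≈b
  when-cong (no _)  (no _)  _   a≈b = ≈-refl
  when-cong (yes p) (no ¬q) P⇔Q a≈b = contradiction (Equivalence.to P⇔Q p) ¬q
  when-cong (no ¬p) (yes q) P⇔Q a≈b = contradiction (Equivalence.from P⇔Q q) ¬p

  when-congʳ : {P : Set} (d : Dec P) → ∀ {a b} → a ≈ b → when d a ≈ when d b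
  when-congʳ d = when-cong d d (mk⇔ id id)

  when-sumOver : {A P : Set} (d : Dec P) (xs : List A) (f : A → Carrier) →
    when d (sumOver xs f) ≈ sumOver xs (λ x → when d (f x))
  when-sumOver (yes _) xs f = ≈-refl
  when-sumOver (no _)  xs f = ≈-sym (sumOver-zero xs (λ _ → ≈-refl))

  sumOver-filterBy : (lem : ExcludedMiddle 0ℓ) {A : Set} (P : A → Set) (xs : List A) (f : A → Carrier) →
    sumOver (filterBy lem P xs) f ≈ sumOver xs (λ x → when (lem {P x}) (f x))
  sumOver-filterBy lem P []       f = ≈-refl
  sumOver-filterBy lem P (x ∷ xs) f with lem {P x}
  ... | yes _ = +-congˡ (sumOver-filterBy lem P xs f)
  ... | no _  = ≈-trans (sumOver-filterBy lem P xs f) (≈-sym (+-identityˡ _))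

  sumOver-allSubsets-suc : ∀ k (f : Subset (suc k) → Carrier) →
    sumOver (allSubsets (suc k)) f ≈
    sumOver (allSubsets k) (f ∘ (outside ∷_)) + sumOver (allSubsets k) (f ∘ (inside ∷_))
  sumOver-allSubsets-suc k f = begin
    sumOver (map (outside ∷_) (allSubsets k) ++ map (inside ∷_) (allSubsets k)) f
      ≈⟨ sumOver-++ (map (outside ∷_) (allSubsets k)) _ f ⟩
    sumOver (map (outside ∷_) (allSubsets k)) f + sumOver (map (inside ∷_) (allSubsets k)) f
      ≡⟨ cong₂ _+_ (sumOver-map (outside ∷_) (allSubsets k) f) (sumOver-map (inside ∷_) (allSubsets k) f) ⟩
    sumOver (allSubsets k) (f ∘ (outside ∷_)) + sumOver (allSubsets k) (f ∘ (inside ∷_)) ∎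

  sumOver-allSubsets-head : ∀ k {s s′} (S₀ : Subset k) (f : Subset (suc k) → Carrier) →
    (∀ S → S ≢ s ∷ S₀ → f S ≈ 0#) → s′ ≢ s → sumOver (allSubsets k) (f ∘ (s′ ∷_)) ≈ 0#
  sumOver-allSubsets-head k S₀ f f≈0 s′≢s =
    sumOver-zero (allSubsets k) (λ _ → f≈0 _ (λ { refl → s′≢s refl }))

  sumOver-allSubsets-single : ∀ k (S₀ : Subset k) (f : Subset k → Carrier) →
    (∀ S → S ≢ S₀ → f S ≈ 0#) → sumOver (allSubsets k) f ≈ f S₀

  sumOver-allSubsets-tail : ∀ k {s} (S₀ : Subset k) (f : Subset (suc k) → Carrier) →
    (∀ S → S ≢ s ∷ S₀ → f S ≈ 0#) → sumOver (allSubsets k) (f ∘ (s ∷_)) ≈ f (s ∷ S₀)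
  sumOver-allSubsets-tail k S₀ f f≈0 =
    sumOver-allSubsets-single k S₀ _ (λ S S≢S₀ → f≈0 _ (λ { refl → S≢S₀ refl }))

  sumOver-allSubsets-single zero    []ᵛ f _ = +-identityʳ _
  sumOver-allSubsets-single (suc k) (outside ∷ S₀) f f≈0 = begin
    sumOver (allSubsets (suc k)) f                                           ≈⟨ sumOver-allSubsets-suc k f ⟩
    sumOver (allSubsets k) (f ∘ (outside ∷_)) + sumOver (allSubsets k) (f ∘ (inside ∷_))
      ≈⟨ +-cong (sumOver-allSubsets-tail k S₀ f f≈0) (sumOver-allSubsets-head k S₀ f f≈0 λ ()) ⟩
    f (outside ∷ S₀) + 0#                                                    ≈⟨ +-identityʳ _ ⟩
    f (outside ∷ S₀)                                                         ∎
  sumOver-allSubsets-single (suc k) (inside ∷ S₀) f f≈0 = begin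
    sumOver (allSubsets (suc k)) f                                           ≈⟨ sumOver-allSubsets-suc k f ⟩
    sumOver (allSubsets k) (f ∘ (outside ∷_)) + sumOver (allSubsets k) (f ∘ (inside ∷_))
      ≈⟨ +-cong (sumOver-allSubsets-head k S₀ f f≈0 λ ()) (sumOver-allSubsets-tail k S₀ f f≈0) ⟩
    0# + f (inside ∷ S₀)                                                     ≈⟨ +-identityˡ _ ⟩
    f (inside ∷ S₀)                                                          ∎


-- Summing over an interval of subsets

Sandwiched : ∀ {k} → Subset k → (Fin k → Set) → Subset k → Set
Sandwiched L A S = L ⊆ S × (∀ {e} → e ∈ S → e ∈ L ⊎ A e)

module _ {k} {L S : Subset k} {A : Fin (suc k) → Set} where

  Sandwiched-s∷s⇔ : ∀ {s} → Sandwiched (s ∷ L) A (s ∷ S) ⇔ Sandwiched L (A ∘ Fin.suc) S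
  Sandwiched-s∷s⇔ = mk⇔
    (λ (L⊆S , S⊆L∪A) → drop-∷-⊆ L⊆S , Sum.map₁ drop-there ∘ S⊆L∪A ∘ thereᵛ)
    (λ (L⊆S , S⊆L∪A) → s⊆s L⊆S , λ { hereᵛ → inj₁ hereᵛ ; (thereᵛ e∈S) → Sum.map₁ thereᵛ (S⊆L∪A e∈S) })

  ¬Sandwiched-in∷out : ¬ Sandwiched (inside ∷ L) A (outside ∷ S)
  ¬Sandwiched-in∷out (L⊆S , _) with L⊆S hereᵛ
  ... | ()

  Sandwiched-out∷in⇔ : Sandwiched (outside ∷ L) A (inside ∷ S) ⇔ (A Fin.zero × Sandwiched L (A ∘ Fin.suc) S)
  Sandwiched-out∷in⇔ = mk⇔
    (λ (L⊆S , S⊆L∪A) → zero∈A (S⊆L∪A hereᵛ) , drop-∷-⊆ L⊆S , Sum.map₁ drop-there ∘ S⊆L∪A ∘ thereᵛ)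
    (λ (A0 , L⊆S , S⊆L∪A) → out⊆ L⊆S , λ { hereᵛ → inj₂ A0 ; (thereᵛ e∈S) → Sum.map₁ thereᵛ (S⊆L∪A e∈S) })
    where
      zero∈A : Fin.zero ∈ outside ∷ L ⊎ A Fin.zero → A Fin.zero
      zero∈A (inj₂ A0) = A0

module IntervalSum (lem : ExcludedMiddle 0ℓ) {c ℓ} (R : CommutativeRing c ℓ)
                   (x : CommutativeRing.Carrier R) where
  open CommutativeRing R renaming (refl to ≈-refl; sym to ≈-sym; trans to ≈-trans)
  open Sums R
  open Classical lem using (countBy-tabulate)
  open import Relation.Binary.Reasoning.Setoid setoid

  intervalTerm : ∀ {k} → Subset k → (Fin k → Set) → Subset k → Carrier
  intervalTerm L A S = when (lem {Sandwiched L A S}) (pow R x (∣ S ∣ ∸ ∣ L ∣))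

  module _ {k} {L S : Subset k} {A : Fin (suc k) → Set} where

    intervalTerm-s∷s : ∀ s → intervalTerm (s ∷ L) A (s ∷ S) ≈ intervalTerm L (A ∘ Fin.suc) S
    intervalTerm-s∷s inside  = when-cong (lem {Sandwiched _ A _}) (lem {Sandwiched L _ S}) Sandwiched-s∷s⇔ ≈-refl
    intervalTerm-s∷s outside = when-cong (lem {Sandwiched _ A _}) (lem {Sandwiched L _ S}) Sandwiched-s∷s⇔ ≈-refl

    intervalTerm-in∷out : intervalTerm (inside ∷ L) A (outside ∷ S) ≈ 0#
    intervalTerm-in∷out = when-no (lem {Sandwiched _ A _}) ¬Sandwiched-in∷out _

    intervalTerm-out∷in : intervalTerm (outside ∷ L) A (inside ∷ S) ≈
                          when (lem {A Fin.zero}) (x * intervalTerm L (A ∘ Fin.suc) S)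
    intervalTerm-out∷in with lem {A Fin.zero} | lem {Sandwiched L (A ∘ Fin.suc) S}
    ... | yes A0 | yes sw@(L⊆S , _) = begin
      intervalTerm (outside ∷ L) A (inside ∷ S)
        ≈⟨ when-yes (lem {Sandwiched _ A _}) (Equivalence.from Sandwiched-out∷in⇔ (A0 , sw)) _ ⟩
      pow R x (suc ∣ S ∣ ∸ ∣ L ∣)  ≡⟨ cong (pow R x) (+-∸-assoc 1 (p⊆q⇒∣p∣≤∣q∣ L⊆S)) ⟩
      x * pow R x (∣ S ∣ ∸ ∣ L ∣)  ∎
    ... | yes _  | no ¬sw =
      ≈-trans (when-no (lem {Sandwiched _ A _}) (¬sw ∘ proj₂ ∘ Equivalence.to Sandwiched-out∷in⇔) _)
              (≈-sym (zeroʳ x))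
    ... | no ¬A0 | _ = when-no (lem {Sandwiched _ A _}) (¬A0 ∘ proj₁ ∘ Equivalence.to Sandwiched-out∷in⇔) _

  intervalSum : ∀ k (L : Subset k) (A : Fin k → Set) → (∀ {e} → A e → e ∉ L) →
    sumOver (allSubsets k) (intervalTerm L A) ≈ pow R (1# + x) (countBy lem A (allFin k))
  intervalSum zero []ᵛ A _ =
    ≈-trans (+-identityʳ _) (when-yes (lem {Sandwiched []ᵛ A []ᵛ}) ((λ ()) , λ ()) 1#)
  intervalSum (suc k) (inside ∷ L) A A∩L=∅ with lem {A Fin.zero}
  ... | yes A0 = contradiction hereᵛ (A∩L=∅ A0)
  ... | no _ = begin
    sumOver (allSubsets (suc k)) (intervalTerm (inside ∷ L) A)           ≈⟨ sumOver-allSubsets-suc k _ ⟩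
    sumOver (allSubsets k) (λ S → intervalTerm (inside ∷ L) A (outside ∷ S)) +
    sumOver (allSubsets k) (λ S → intervalTerm (inside ∷ L) A (inside ∷ S))
      ≈⟨ +-cong (sumOver-zero (allSubsets k) (λ _ → intervalTerm-in∷out))
                (sumOver-cong (allSubsets k) (λ _ → intervalTerm-s∷s inside)) ⟩
    0# + sumOver (allSubsets k) (intervalTerm L (A ∘ Fin.suc))            ≈⟨ +-identityˡ _ ⟩
    sumOver (allSubsets k) (intervalTerm L (A ∘ Fin.suc))
      ≈⟨ intervalSum k L (A ∘ Fin.suc) (λ Ae → A∩L=∅ Ae ∘ thereᵛ) ⟩
    pow R (1# + x) (countBy lem (A ∘ Fin.suc) (allFin k))
      ≡⟨ cong (pow R (1# + x)) (countBy-tabulate A Fin.suc) ⟨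
    pow R (1# + x) (countBy lem A (tabulate Fin.suc)) ∎
  intervalSum (suc k) (outside ∷ L) A A∩L=∅ = begin
    sumOver (allSubsets (suc k)) (intervalTerm (outside ∷ L) A)          ≈⟨ sumOver-allSubsets-suc k _ ⟩
    sumOver (allSubsets k) (λ S → intervalTerm (outside ∷ L) A (outside ∷ S)) +
    sumOver (allSubsets k) (λ S → intervalTerm (outside ∷ L) A (inside ∷ S))
      ≈⟨ +-cong (sumOver-cong (allSubsets k) (λ _ → intervalTerm-s∷s outside))
                (sumOver-cong (allSubsets k) (λ _ → intervalTerm-out∷in)) ⟩
    Σt + sumOver (allSubsets k) (λ S → when A0? (x * t S))
      ≈⟨ +-congˡ (≈-sym (when-sumOver A0? (allSubsets k) _)) ⟩
    Σt + when A0? (sumOver (allSubsets k) (λ S → x * t S))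
      ≈⟨ +-congˡ (when-congʳ A0? (≈-sym (sumOver-*ˡ (allSubsets k) t x))) ⟩
    Σt + when A0? (x * Σt)
      ≈⟨ head-step ⟩
    pow R (1# + x) (countBy lem A (allFin (suc k))) ∎
    where
      A0? : Dec (A Fin.zero)
      A0? = lem
      t : Subset k → Carrier
      t = intervalTerm L (A ∘ Fin.suc)
      Σt : Carrier
      Σt = sumOver (allSubsets k) t
      IH : Σt ≈ pow R (1# + x) (countBy lem A (tabulate Fin.suc))
      IH = ≈-trans (intervalSum k L (A ∘ Fin.suc) (λ Ae → A∩L=∅ Ae ∘ thereᵛ))
                 (reflexive (cong (pow R (1# + x)) (sym (countBy-tabulate A Fin.suc))))
      head-step : Σt + when A0? (x * Σt) ≈ pow R (1# + x) (countBy lem A (allFin (suc k)))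
      head-step with lem {A Fin.zero}
      ... | yes _ = begin
        Σt + x * Σt                                             ≈⟨ +-congʳ (*-identityˡ Σt) ⟨
        1# * Σt + x * Σt                                        ≈⟨ distribʳ Σt 1# x ⟨
        (1# + x) * Σt                                           ≈⟨ *-congˡ IH ⟩
        (1# + x) * pow R (1# + x) (countBy lem A (tabulate Fin.suc)) ∎
      ... | no _ = ≈-trans (+-identityʳ Σt) IH

module GainGraphTheory {𝔊 : LatticeOrderedGroup} {𝔚 : WeightSemigroup 𝔊}
                       (lem : ExcludedMiddle 0ℓ) (ΦH : WeightedGainGraph 𝔊 𝔚) where
  open LatticeOrderedGroup 𝔊 renaming (Carrier to G)
  open WeightedGainGraph ΦH
  open GainGraphNotions lem ΦH
  open Classical lem
  open IsGroup isGroup using (assoc; identityˡ; identityʳ; inverseˡ; inverseʳ)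

  gainGroup : Group 0ℓ 0ℓ
  gainGroup = record { isGroup = isGroup }

  open import Algebra.Properties.Group gainGroup
    using (ε⁻¹≈ε; ⁻¹-anti-homo-∙; ⁻¹-involutive; inverseʳ-unique)

  -- Walks, paths and circles

  ordinary-injective : ∀ {a b a′ b′ g g′} → _≡_ {A = Edge n G} (ordinary a b g) (ordinary a′ b′ g′) →
                       a ≡ a′ × b ≡ b′ × g ≡ g′
  ordinary-injective refl = refl , refl , refl

  ∈-edges : ∀ {S x y g} (p : Walk S x y g) {f} → f ∈ₗ edges p → f ∈ S
  ∈-edges (fwd e e∈S _ _) (here refl) = e∈S
  ∈-edges (bwd e e∈S _ _) (here refl) = e∈S
  ∈-edges (fwd _ _ _ p)   (there f∈)  = ∈-edges p f∈
  ∈-edges (bwd _ _ _ p)   (there f∈)  = ∈-edges p f∈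

  transport : ∀ {S T x y g} (p : Walk S x y g) → (∀ {f} → f ∈ₗ edges p → f ∈ T) → Walk T x y g
  transport []              _  = []
  transport (fwd e _ eq p) ⊆T = fwd e (⊆T (here refl)) eq (transport p (⊆T ∘ there))
  transport (bwd e _ eq p) ⊆T = bwd e (⊆T (here refl)) eq (transport p (⊆T ∘ there))

  edges-transport : ∀ {S T x y g} (p : Walk S x y g) (⊆T : ∀ {f} → f ∈ₗ edges p → f ∈ T) →
                    edges (transport p ⊆T) ≡ edges p
  edges-transport []             _ = refl
  edges-transport (fwd e _ _ p) _ = cong (e ∷_) (edges-transport p _)
  edges-transport (bwd e _ _ p) _ = cong (e ∷_) (edges-transport p _)

  vertices-transport : ∀ {S T x y g} (p : Walk S x y g) (⊆T : ∀ {f} → f ∈ₗ edges p → f ∈ T) →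
                       vertices (transport p ⊆T) ≡ vertices p
  vertices-transport               []             _ = refl
  vertices-transport {x = x} (fwd _ _ _ p) _ = cong (x ∷_) (vertices-transport p _)
  vertices-transport {x = x} (bwd _ _ _ p) _ = cong (x ∷_) (vertices-transport p _)

  IsPath-transport : ∀ {S T x y g} (p : Walk S x y g) (⊆T : ∀ {f} → f ∈ₗ edges p → f ∈ T) →
                     IsPath p → IsPath (transport p ⊆T)
  IsPath-transport p ⊆T = subst Unique (sym (vertices-transport p ⊆T))

  IsCircleWalk-transport : ∀ {S T x g} (p : Walk S x x g) (⊆T : ∀ {f} → f ∈ₗ edges p → f ∈ T) →
                           IsCircleWalk p → IsCircleWalk (transport p ⊆T)
  IsCircleWalk-transport p ⊆T rewrite edges-transport p ⊆T | vertices-transport p ⊆T = λ c → c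

  walk-mono : ∀ {S T x y g} → S ⊆ T → Walk S x y g → Walk T x y g
  walk-mono S⊆T p = transport p (S⊆T ∘ ∈-edges p)

  ∈-circle : ∀ {S es g} → Circle S es g → ∀ {f} → f ∈ₗ es → f ∈ S
  ∈-circle (walkCircle p _)      = ∈-edges p
  ∈-circle (looseCircle _ e∈S _) (here refl) = e∈S

  circle-transport : ∀ {S T es g} → Circle S es g → (∀ {f} → f ∈ₗ es → f ∈ T) → Circle T es g
  circle-transport (walkCircle p circ) ⊆T =
    subst (λ es → Circle _ es _) (edges-transport p ⊆T)
          (walkCircle (transport p ⊆T) (IsCircleWalk-transport p ⊆T circ))
  circle-transport (looseCircle e _ eq) ⊆T = looseCircle e (⊆T (here refl)) eq

  circle-mono : ∀ {S T es g} → S ⊆ T → Circle S es g → Circle T es g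
  circle-mono S⊆T C = circle-transport C (S⊆T ∘ ∈-circle C)

  infixr 5 _++ʷ_
  _++ʷ_ : ∀ {S x y z g h} → Walk S x y g → Walk S y z h → Walk S x z (g ∙ h)
  _++ʷ_ {h = h} [] q = subst (Walk _ _ _) (sym (identityˡ h)) q
  _++ʷ_ {h = h} (fwd {g = g₀} {g′} e e∈S eq p) q =
    subst (Walk _ _ _) (sym (assoc g₀ g′ h)) (fwd e e∈S eq (p ++ʷ q))
  _++ʷ_ {h = h} (bwd {g = g₀} {g′} e e∈S eq p) q =
    subst (Walk _ _ _) (sym (assoc (g₀ ⁻¹) g′ h)) (bwd e e∈S eq (p ++ʷ q))

  reverse : ∀ {S x y g} → Walk S x y g → Walk S y x (g ⁻¹)
  reverse [] = subst (Walk _ _ _) (sym ε⁻¹≈ε) []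
  reverse (fwd {g = g₀} {g′} e e∈S eq p) =
    subst (Walk _ _ _) (trans (cong (g′ ⁻¹ ∙_) (identityʳ (g₀ ⁻¹))) (sym (⁻¹-anti-homo-∙ g₀ g′)))
          (reverse p ++ʷ bwd e e∈S eq [])
  reverse (bwd {g = g₀} {g′} e e∈S eq p) =
    subst (Walk _ _ _)
          (trans (cong (g′ ⁻¹ ∙_) (trans (identityʳ g₀) (sym (⁻¹-involutive g₀))))
                 (sym (⁻¹-anti-homo-∙ (g₀ ⁻¹) g′)))
          (reverse p ++ʷ fwd e e∈S eq [])

  Connected-refl : ∀ {S x} → Connected S x x
  Connected-refl = ε , []

  Connected-sym : ∀ {S x y} → Connected S x y → Connected S y x
  Connected-sym (_ , p) = _ , reverse p

  Connected-trans : ∀ {S x y z} → Connected S x y → Connected S y z → Connected S x z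
  Connected-trans (_ , p) (_ , q) = _ , p ++ʷ q

  Connected-mono : ∀ {S T x y} → S ⊆ T → Connected S x y → Connected T x y
  Connected-mono S⊆T (_ , p) = _ , walk-mono S⊆T p

  first∈vertices : ∀ {S x y g} (p : Walk S x y g) → x ∈ₗ vertices p
  first∈vertices []            = here refl
  first∈vertices (fwd _ _ _ _) = here refl
  first∈vertices (bwd _ _ _ _) = here refl

  last∈vertices : ∀ {S x y g} (p : Walk S x y g) → y ∈ₗ vertices p
  last∈vertices []            = here refl
  last∈vertices (fwd _ _ _ p) = there (last∈vertices p)
  last∈vertices (bwd _ _ _ p) = there (last∈vertices p)

  endpoints∈vertices : ∀ {S x y g a b g₀ e} (p : Walk S x y g) → edge e ≡ ordinary a b g₀ →
                       e ∈ₗ edges p → a ∈ₗ vertices p × b ∈ₗ vertices p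
  endpoints∈vertices (fwd _ _ eq′ p) eq (here refl) =
    let a≡ , b≡ , _ = ordinary-injective (trans (sym eq) eq′)
    in here a≡ , there (subst (_∈ₗ vertices p) (sym b≡) (first∈vertices p))
  endpoints∈vertices (bwd _ _ eq′ p) eq (here refl) =
    let a≡ , b≡ , _ = ordinary-injective (trans (sym eq) eq′)
    in there (subst (_∈ₗ vertices p) (sym a≡) (first∈vertices p)) , here b≡
  endpoints∈vertices (fwd _ _ _ p) eq (there e∈) =
    Product.map there there (endpoints∈vertices p eq e∈)
  endpoints∈vertices (bwd _ _ _ p) eq (there e∈) =
    Product.map there there (endpoints∈vertices p eq e∈)

  ∈-edges⇒ordinary : ∀ {S x y g f} (p : Walk S x y g) → f ∈ₗ edges p →
                     Σ (Fin n) λ a → Σ (Fin n) λ b → Σ G λ g₀ → edge f ≡ ordinary a b g₀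
  ∈-edges⇒ordinary (fwd _ _ eq _) (here refl) = _ , _ , _ , eq
  ∈-edges⇒ordinary (bwd _ _ eq _) (here refl) = _ , _ , _ , eq
  ∈-edges⇒ordinary (fwd _ _ _ p)  (there f∈)  = ∈-edges⇒ordinary p f∈
  ∈-edges⇒ordinary (bwd _ _ _ p)  (there f∈)  = ∈-edges⇒ordinary p f∈

  IsPath⇒Unique-edges : ∀ {S x y g} (p : Walk S x y g) → IsPath p → Unique (edges p)
  IsPath⇒Unique-edges []               _ = []
  IsPath⇒Unique-edges (fwd _ _ eq p) (x∉ ∷ u) =
    ¬Any⇒All¬ (edges p) (λ e∈ → All.lookup x∉ (proj₁ (endpoints∈vertices p eq e∈)) refl)
    ∷ IsPath⇒Unique-edges p u
  IsPath⇒Unique-edges (bwd _ _ eq p) (x∉ ∷ u) =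
    ¬Any⇒All¬ (edges p) (λ e∈ → All.lookup x∉ (proj₂ (endpoints∈vertices p eq e∈)) refl)
    ∷ IsPath⇒Unique-edges p u

  closedPath-trivial : ∀ {S x g} (p : Walk S x x g) → IsPath p → g ≡ ε × edges p ≡ []
  closedPath-trivial []             _        = refl , refl
  closedPath-trivial (fwd _ _ _ p) (x∉ ∷ _) = ⊥-elim (All.lookup x∉ (last∈vertices p) refl)
  closedPath-trivial (bwd _ _ _ p) (x∉ ∷ _) = ⊥-elim (All.lookup x∉ (last∈vertices p) refl)

  record PathSplit {T b y g} (q : Walk T b y g) (x : Fin n) : Set where
    field
      {gα gβ} : G
      α       : Walk T b x gα
      β       : Walk T x y gβ
      gain≡   : g ≡ gα ∙ gβ
      α-path  : IsPath α
      β-path  : IsPath β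
      α⊆q     : ∀ {z} → z ∈ₗ vertices α → z ∈ₗ vertices q

  splitPath : ∀ {T b y g x} (q : Walk T b y g) → IsPath q → x ∈ₗ vertices q → PathSplit q x
  splitPath [] _ (here refl) =
    record { α = [] ; β = [] ; gain≡ = sym (identityˡ ε) ; α-path = [] ∷ [] ; β-path = [] ∷ []
           ; α⊆q = λ z∈ → z∈ }
  splitPath q@(fwd _ _ _ _) q-path (here refl) =
    record { α = [] ; β = q ; gain≡ = sym (identityˡ _) ; α-path = [] ∷ [] ; β-path = q-path
           ; α⊆q = λ { (here refl) → here refl } }
  splitPath q@(bwd _ _ _ _) q-path (here refl) =
    record { α = [] ; β = q ; gain≡ = sym (identityˡ _) ; α-path = [] ∷ [] ; β-path = q-path
           ; α⊆q = λ { (here refl) → here refl } }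
  splitPath (fwd {g = g₀} e e∈T eq q) (b∉ ∷ q-path) (there x∈) =
    let open PathSplit (splitPath q q-path x∈) in
    record { α = fwd e e∈T eq α ; β = β
           ; gain≡ = trans (cong (g₀ ∙_) gain≡) (sym (assoc g₀ gα gβ))
           ; α-path = All.tabulate (All.lookup b∉ ∘ α⊆q) ∷ α-path ; β-path = β-path
           ; α⊆q = λ { (here refl) → here refl ; (there z∈) → there (α⊆q z∈) } }
  splitPath (bwd {g = g₀} e e∈T eq q) (b∉ ∷ q-path) (there x∈) =
    let open PathSplit (splitPath q q-path x∈) in
    record { α = bwd e e∈T eq α ; β = β
           ; gain≡ = trans (cong (g₀ ⁻¹ ∙_) gain≡) (sym (assoc (g₀ ⁻¹) gα gβ))
           ; α-path = All.tabulate (All.lookup b∉ ∘ α⊆q) ∷ α-path ; β-path = β-path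
           ; α⊆q = λ { (here refl) → here refl ; (there z∈) → there (α⊆q z∈) } }

  -- Balanced edge sets

  Balanced : Subset m → Set
  Balanced T = ∀ v g (p : Walk T v v g) → IsCircleWalk p → g ≡ ε

  private
    ∉[] : ∀ {es : List (Fin m)} {e} → es ≡ [] → ¬ e ∈ₗ es
    ∉[] refl ()

  -- A path back from b to a through the edge e from a to b can only be e itself.
  backtrack-gain : ∀ {T a b g₀ gα e} → edge e ≡ ordinary a b g₀ → (α : Walk T b a gα) → IsPath α →
                   e ∈ₗ edges α → g₀ ∙ gα ≡ ε
  backtrack-gain {a = a} {b} eq α α-path e∈ with a ≟ b
  ... | yes refl = contradiction e∈ (∉[] (proj₂ (closedPath-trivial α α-path)))
  backtrack-gain eq (fwd _ _ eq′ _) _ (here refl) | no a≢b =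
    contradiction (proj₁ (ordinary-injective (trans (sym eq) eq′))) a≢b
  backtrack-gain eq (fwd _ _ _ α) (b∉ ∷ _) (there e∈) | no _ =
    ⊥-elim (All.lookup b∉ (proj₂ (endpoints∈vertices α eq e∈)) refl)
  backtrack-gain {g₀ = g₀} eq (bwd _ _ eq′ α) (_ ∷ α-path) (here refl) | no _
    with ordinary-injective (trans (sym eq) eq′)
  ... | refl , _ , refl with closedPath-trivial α α-path
  ... | refl , _ = trans (cong (g₀ ∙_) (identityʳ (g₀ ⁻¹))) (inverseʳ g₀)
  backtrack-gain eq (bwd _ _ _ α) (b∉ ∷ _) (there e∈) | no _ =
    ⊥-elim (All.lookup b∉ (proj₂ (endpoints∈vertices α eq e∈)) refl)

  backtrack-gain⁻¹ : ∀ {T a b g₀ gα e} → edge e ≡ ordinary a b g₀ → (α : Walk T a b gα) → IsPath α →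
                     e ∈ₗ edges α → g₀ ⁻¹ ∙ gα ≡ ε
  backtrack-gain⁻¹ {a = a} {b} eq α α-path e∈ with a ≟ b
  ... | yes refl = contradiction e∈ (∉[] (proj₂ (closedPath-trivial α α-path)))
  backtrack-gain⁻¹ {g₀ = g₀} eq (fwd _ _ eq′ α) (_ ∷ α-path) (here refl) | no _
    with ordinary-injective (trans (sym eq) eq′)
  ... | _ , refl , refl with closedPath-trivial α α-path
  ... | refl , _ = trans (cong (g₀ ⁻¹ ∙_) (identityʳ g₀)) (inverseˡ g₀)
  backtrack-gain⁻¹ eq (fwd _ _ _ α) (a∉ ∷ _) (there e∈) | no _ =
    ⊥-elim (All.lookup a∉ (proj₁ (endpoints∈vertices α eq e∈)) refl)
  backtrack-gain⁻¹ eq (bwd _ _ eq′ _) _ (here refl) | no a≢b =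
    contradiction (sym (proj₁ (proj₂ (ordinary-injective (trans (sym eq) eq′))))) a≢b
  backtrack-gain⁻¹ eq (bwd _ _ _ α) (a∉ ∷ _) (there e∈) | no _ =
    ⊥-elim (All.lookup a∉ (proj₁ (endpoints∈vertices α eq e∈)) refl)

  ∙-cancel : ∀ x y z → x ∙ y ≡ ε → x ∙ (y ∙ z) ≡ z
  ∙-cancel x y z xy≡ε = trans (sym (assoc x y z)) (trans (cong (_∙ z) xy≡ε) (identityˡ z))

  -- Shortcutting a revisited vertex drops a closed path through it; that loop is either a circle,
  -- of gain ε by balance, or one edge walked back and forth, so the gain of the walk is kept.
  toPath : ∀ {T x y g} → Balanced T → Walk T x y g → Σ (Walk T x y g) IsPath
  toPath B [] = [] , [] ∷ []
  toPath {T} B (fwd {a} {b} {w} {g₀} e e∈T eq q) with toPath B q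
  ... | q′ , q′-path with lem {a ∈ₗ vertices q′}
  ... | no a∉ = fwd e e∈T eq q′ , ¬Any⇒All¬ _ a∉ ∷ q′-path
  ... | yes a∈ = subst (λ h → Σ (Walk T a w h) IsPath)
                       (sym (trans (cong (g₀ ∙_) gain≡) (∙-cancel g₀ gα gβ loop-gain))) (β , β-path)
    where
      open PathSplit (splitPath q′ q′-path a∈)
      loop-gain : g₀ ∙ gα ≡ ε
      loop-gain with lem {e ∈ₗ edges α}
      ... | yes e∈α = backtrack-gain eq α α-path e∈α
      ... | no e∉α = B a _ (fwd e e∈T eq α)
                       ((λ ()) , ¬Any⇒All¬ _ e∉α ∷ IsPath⇒Unique-edges α α-path , α-path)
  toPath {T} B (bwd {a} {b} {w} {g₀} e e∈T eq q) with toPath B q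
  ... | q′ , q′-path with lem {b ∈ₗ vertices q′}
  ... | no b∉ = bwd e e∈T eq q′ , ¬Any⇒All¬ _ b∉ ∷ q′-path
  ... | yes b∈ = subst (λ h → Σ (Walk T b w h) IsPath)
                       (sym (trans (cong (g₀ ⁻¹ ∙_) gain≡) (∙-cancel (g₀ ⁻¹) gα gβ loop-gain))) (β , β-path)
    where
      open PathSplit (splitPath q′ q′-path b∈)
      loop-gain : g₀ ⁻¹ ∙ gα ≡ ε
      loop-gain with lem {e ∈ₗ edges α}
      ... | yes e∈α = backtrack-gain⁻¹ eq α α-path e∈α
      ... | no e∉α = B b _ (bwd e e∈T eq α)
                       ((λ ()) , ¬Any⇒All¬ _ e∉α ∷ IsPath⇒Unique-edges α α-path , α-path)

  closedWalk-gain : ∀ {T x g} → Balanced T → Walk T x x g → g ≡ ε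
  closedWalk-gain B p = let p′ , p′-path = toPath B p in proj₁ (closedPath-trivial p′ p′-path)

  walk-gain-unique : ∀ {T x y g h} → Balanced T → Walk T x y g → Walk T x y h → g ≡ h
  walk-gain-unique {g = g} {h} B p q = begin
    g               ≡⟨ sym (⁻¹-involutive g) ⟩
    g ⁻¹ ⁻¹         ≡⟨ cong _⁻¹ (sym (inverseʳ-unique g (h ⁻¹) (closedWalk-gain B (p ++ʷ reverse q)))) ⟩
    h ⁻¹ ⁻¹         ≡⟨ ⁻¹-involutive h ⟩
    h               ∎
    where open ≡-Reasoning

  data EdgeCut (T : Subset m) (x y : Fin n) (g : G) (a b : Fin n) (g₀ : G) : Set where
    forwardCut  : ∀ {gα gβ} → Walk T x a gα → Walk T b y gβ → g ≡ gα ∙ (g₀ ∙ gβ) → EdgeCut T x y g a b g₀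
    backwardCut : ∀ {gα gβ} → Walk T x b gα → Walk T a y gβ → g ≡ gα ∙ (g₀ ⁻¹ ∙ gβ) → EdgeCut T x y g a b g₀

  private
    prepend : ∀ {T x x′ y g g′ a b g₀ f} → f ∈ T → edge f ≡ ordinary x x′ g′ →
              EdgeCut T x′ y g a b g₀ → EdgeCut T x y (g′ ∙ g) a b g₀
    prepend {g′ = g′} f∈T eq (forwardCut α β g≡) =
      forwardCut (fwd _ f∈T eq α) β (trans (cong (g′ ∙_) g≡) (sym (assoc g′ _ _)))
    prepend {g′ = g′} f∈T eq (backwardCut α β g≡) =
      backwardCut (fwd _ f∈T eq α) β (trans (cong (g′ ∙_) g≡) (sym (assoc g′ _ _)))

    prepend⁻¹ : ∀ {T x x′ y g g′ a b g₀ f} → f ∈ T → edge f ≡ ordinary x′ x g′ →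
                EdgeCut T x′ y g a b g₀ → EdgeCut T x y (g′ ⁻¹ ∙ g) a b g₀
    prepend⁻¹ {g′ = g′} f∈T eq (forwardCut α β g≡) =
      forwardCut (bwd _ f∈T eq α) β (trans (cong (g′ ⁻¹ ∙_) g≡) (sym (assoc (g′ ⁻¹) _ _)))
    prepend⁻¹ {g′ = g′} f∈T eq (backwardCut α β g≡) =
      backwardCut (bwd _ f∈T eq α) β (trans (cong (g′ ⁻¹ ∙_) g≡) (sym (assoc (g′ ⁻¹) _ _)))

  cutAtEdge : ∀ {U T x y g a b g₀ e} (p : Walk U x y g) → Unique (edges p) → e ∈ₗ edges p →
              (∀ {f} → f ∈ₗ edges p → f ≢ e → f ∈ T) → edge e ≡ ordinary a b g₀ → EdgeCut T x y g a b g₀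
  cutAtEdge (fwd f _ eq′ p) (f∉ ∷ _) (here refl) ⊆T eq with ordinary-injective (trans (sym eq) eq′)
  ... | refl , refl , refl =
    forwardCut [] (transport p (λ f′∈ → ⊆T (there f′∈) (λ { refl → All.lookup f∉ f′∈ refl })))
               (sym (identityˡ _))
  cutAtEdge (bwd f _ eq′ p) (f∉ ∷ _) (here refl) ⊆T eq with ordinary-injective (trans (sym eq) eq′)
  ... | refl , refl , refl =
    backwardCut [] (transport p (λ f′∈ → ⊆T (there f′∈) (λ { refl → All.lookup f∉ f′∈ refl })))
                (sym (identityˡ _))
  cutAtEdge (fwd _ _ eq′ p) (f∉ ∷ u) (there e∈) ⊆T eq =
    prepend (⊆T (here refl) (All.lookup f∉ e∈)) eq′ (cutAtEdge p u e∈ (λ f∈ → ⊆T (there f∈)) eq)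
  cutAtEdge (bwd _ _ eq′ p) (f∉ ∷ u) (there e∈) ⊆T eq =
    prepend⁻¹ (⊆T (here refl) (All.lookup f∉ e∈)) eq′ (cutAtEdge p u e∈ (λ f∈ → ⊆T (there f∈)) eq)

  ε≡x∙[y∙z]⇒y≡[z∙x]⁻¹ : ∀ x y z → ε ≡ x ∙ (y ∙ z) → y ≡ (z ∙ x) ⁻¹
  ε≡x∙[y∙z]⇒y≡[z∙x]⁻¹ x y z ε≡ = begin
    y                ≡⟨ sym (identityʳ y) ⟩
    y ∙ ε            ≡⟨ cong (y ∙_) (sym (inverseʳ z)) ⟩
    y ∙ (z ∙ z ⁻¹)   ≡⟨ sym (assoc y z (z ⁻¹)) ⟩
    (y ∙ z) ∙ z ⁻¹   ≡⟨ cong (_∙ z ⁻¹) (inverseʳ-unique x (y ∙ z) (sym ε≡)) ⟩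
    x ⁻¹ ∙ z ⁻¹      ≡⟨ sym (⁻¹-anti-homo-∙ z x) ⟩
    (z ∙ x) ⁻¹       ∎
    where open ≡-Reasoning

  ε≡x∙[y⁻¹∙z]⇒y≡z∙x : ∀ x y z → ε ≡ x ∙ (y ⁻¹ ∙ z) → y ≡ z ∙ x
  ε≡x∙[y⁻¹∙z]⇒y≡z∙x x y z ε≡ =
    trans (sym (⁻¹-involutive y))
          (trans (cong _⁻¹ (ε≡x∙[y∙z]⇒y≡[z∙x]⁻¹ x (y ⁻¹) z ε≡)) (⁻¹-involutive (z ∙ x)))

  ParallelWalk : Subset m → Fin m → Set
  ParallelWalk T e = edge e ≡ loose ⊎
    (Σ (Fin n) λ a → Σ (Fin n) λ b → Σ G λ g₀ → edge e ≡ ordinary a b g₀ × Walk T a b g₀)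

  balancedCircle⇒ParallelWalk : ∀ {F e es} → SpanningForest F → Circle (F ∪ ⁅ e ⁆) es ε → ParallelWalk F e
  balancedCircle⇒ParallelWalk (_ , acyclic) (looseCircle e′ e′∈ eq′) with x∈p∪⁅y⁆⁻ e′∈
  ... | inj₁ e′∈F = ⊥-elim (acyclic _ _ (looseCircle e′ e′∈F eq′))
  ... | inj₂ refl = inj₁ eq′
  balancedCircle⇒ParallelWalk {F} {e} (_ , acyclic) (walkCircle p circ@(_ , unique-edges , _))
    with lem {e ∈ₗ edges p}
  ... | no e∉p = ⊥-elim (acyclic _ _ (circle-transport (walkCircle p circ) ⊆F))
    where
      ⊆F : ∀ {f} → f ∈ₗ edges p → f ∈ F
      ⊆F f∈ with x∈p∪⁅y⁆⁻ (∈-edges p f∈)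
      ... | inj₁ f∈F = f∈F
      ... | inj₂ refl = contradiction f∈ e∉p
  ... | yes e∈p with ∈-edges⇒ordinary p e∈p
  ... | a , b , g₀ , eq = inj₂ (a , b , g₀ , eq , parallel (cutAtEdge p unique-edges e∈p ⊆F eq))
    where
      ⊆F : ∀ {f} → f ∈ₗ edges p → f ≢ e → f ∈ F
      ⊆F f∈ f≢e with x∈p∪⁅y⁆⁻ (∈-edges p f∈)
      ... | inj₁ f∈F = f∈F
      ... | inj₂ f≡e = contradiction f≡e f≢e
      parallel : ∀ {v} → EdgeCut F v v ε a b g₀ → Walk F a b g₀
      parallel (forwardCut {gα} {gβ} α β ε≡) =
        subst (Walk F a b) (sym (ε≡x∙[y∙z]⇒y≡[z∙x]⁻¹ gα g₀ gβ ε≡)) (reverse (β ++ʷ α))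
      parallel (backwardCut {gα} {gβ} α β ε≡) =
        subst (Walk F a b) (sym (ε≡x∙[y⁻¹∙z]⇒y≡z∙x gα g₀ gβ ε≡)) (β ++ʷ α)

  SpanningForest-antimono : ∀ {S F} → S ⊆ F → SpanningForest F → SpanningForest S
  SpanningForest-antimono S⊆F (no-half , acyclic) =
    (λ e a e∈S → no-half e a (S⊆F e∈S)) , (λ es g C → acyclic es g (circle-mono S⊆F C))

  SpanningForest⇒Balanced : ∀ {F} → SpanningForest F → Balanced F
  SpanningForest⇒Balanced (_ , acyclic) v g p circ = ⊥-elim (acyclic _ _ (walkCircle p circ))

  forestEdge-ordinary : ∀ {F e} → SpanningForest F → e ∈ F →
                        Σ (Fin n) λ a → Σ (Fin n) λ b → Σ G λ g₀ → edge e ≡ ordinary a b g₀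
  forestEdge-ordinary {e = e} (no-half , acyclic) e∈F = classify (edge e) refl
    where
      classify : ∀ x → edge e ≡ x → Σ (Fin n) λ a → Σ (Fin n) λ b → Σ G λ g₀ → edge e ≡ ordinary a b g₀
      classify (ordinary a b g₀) eq = a , b , g₀ , eq
      classify (half a)          eq = ⊥-elim (no-half e a e∈F eq)
      classify loose             eq = ⊥-elim (acyclic _ _ (looseCircle e e∈F eq))

  -- Connected components and forests

  repOf : ∀ S v → Σ (Fin n) λ r → IsRep S r × Connected S r v
  repOf S v =
    let r , v~r , r-least = minimal <-wellFounded (Connected S v) Connected-refl
    in r , (λ w r~w → ≮⇒≥ (r-least (Connected-trans v~r r~w))) , Connected-sym v~r

  IsRep-unique : ∀ {S r r′} → IsRep S r → IsRep S r′ → Connected S r r′ → r ≡ r′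
  IsRep-unique r-rep r′-rep r~r′ =
    toℕ-injective (≤-antisym (r-rep _ r~r′) (r′-rep _ (Connected-sym r~r′)))

  ¬IsRep⇒smaller : ∀ {S w} → ¬ IsRep S w → Σ (Fin n) λ z → Connected S w z × toℕ z < toℕ w
  ¬IsRep⇒smaller {S} {w} ¬rep with lem {Σ (Fin n) λ z → Connected S w z × toℕ z < toℕ w}
  ... | yes smaller = smaller
  ... | no ∄z = ⊥-elim (¬rep (λ z w~z → ≮⇒≥ (λ z<w → ∄z (z , w~z , z<w))))

  IsRep-antimono : ∀ {S T r} → S ⊆ T → IsRep T r → IsRep S r
  IsRep-antimono S⊆T r-rep w r~w = r-rep w (Connected-mono S⊆T r~w)

  c-∅ : c ∅ ≡ n
  c-∅ = trans (cong length (filter-all (λ r → lem {IsRep ∅ r}) {xs = allFin n} (All.tabulate (λ _ → every-rep))))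
              (length-tabulate id)
    where
      every-rep : ∀ {r} → IsRep ∅ r
      every-rep w (_ , [])          = ≤-refl
      every-rep w (_ , fwd _ e∈ _ _) = contradiction e∈ ∉⊥
      every-rep w (_ , bwd _ e∈ _ _) = contradiction e∈ ∉⊥

  module DeleteForestEdge {F : Subset m} (F-forest : SpanningForest F) {e : Fin m} (e∈F : e ∈ F)
                          {va vb : Fin n} {g₀ : G} (e≡ : edge e ≡ ordinary va vb g₀) where
    F′ : Subset m
    F′ = F ∖ e

    F′⊆F : F′ ⊆ F
    F′⊆F = p─q⊆p F _

    C′ : Fin n → Fin n → Set
    C′ = Connected F′

    separated : ¬ C′ va vb
    separated (_ , p) =
      let α , α-path = toPath (SpanningForest⇒Balanced (SpanningForest-antimono F′⊆F F-forest)) p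
          α′ = walk-mono F′⊆F α
          α′-path = IsPath-transport α _ α-path
          e∉α′ : ¬ e ∈ₗ edges α′
          e∉α′ e∈ = x∉p∖x F e (∈-edges α (subst (e ∈ₗ_) (edges-transport α _) e∈))
      in proj₂ F-forest _ _ (walkCircle (bwd e e∈F e≡ α′)
           ((λ ()) , ¬Any⇒All¬ _ e∉α′ ∷ IsPath⇒Unique-edges α′ α′-path , α′-path))

    a~b : Connected F va vb
    a~b = _ , fwd e e∈F e≡ []

    Crossing : Fin n → Fin n → Set
    Crossing x y = C′ x y ⊎ (C′ x va × C′ vb y) ⊎ (C′ x vb × C′ va y)

    private
      extend : ∀ {x z y} → C′ x z → Crossing z y → Crossing x y
      extend x~z (inj₁ z~y)                = inj₁ (Connected-trans x~z z~y)
      extend x~z (inj₂ (inj₁ (z~a , b~y))) = inj₂ (inj₁ (Connected-trans x~z z~a , b~y))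
      extend x~z (inj₂ (inj₂ (z~b , a~y))) = inj₂ (inj₂ (Connected-trans x~z z~b , a~y))

      cross : ∀ {y} → Crossing vb y → Crossing va y
      cross (inj₁ b~y)               = inj₂ (inj₁ (Connected-refl , b~y))
      cross (inj₂ (inj₁ (b~a , _)))  = contradiction (Connected-sym b~a) separated
      cross (inj₂ (inj₂ (_ , a~y)))  = inj₁ a~y

      cross⁻¹ : ∀ {y} → Crossing va y → Crossing vb y
      cross⁻¹ (inj₁ a~y)              = inj₂ (inj₂ (Connected-refl , a~y))
      cross⁻¹ (inj₂ (inj₁ (_ , b~y))) = inj₁ b~y
      cross⁻¹ (inj₂ (inj₂ (a~b , _))) = contradiction a~b separated

    crossing : ∀ {x y g} → Walk F x y g → Crossing x y
    crossing [] = inj₁ Connected-refl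
    crossing (fwd f f∈F f≡ p) with f ≟ e
    ... | yes refl with ordinary-injective (trans (sym e≡) f≡)
    ... | refl , refl , _ = cross (crossing p)
    crossing (fwd f f∈F f≡ p) | no f≢e = extend (_ , fwd f (x∈p∧x≢y⇒x∈p-y f∈F f≢e) f≡ []) (crossing p)
    crossing (bwd f f∈F f≡ p) with f ≟ e
    ... | yes refl with ordinary-injective (trans (sym e≡) f≡)
    ... | refl , refl , _ = cross⁻¹ (crossing p)
    crossing (bwd f f∈F f≡ p) | no f≢e = extend (_ , bwd f (x∈p∧x≢y⇒x∈p-y f∈F f≢e) f≡ []) (crossing p)

    -- Stated for the endpoint a whose component in F′ has the smaller representative;
    -- c-delete uses it in both orientations.
    module Count (a b r₁ r₂ : Fin n) (r₁-rep : IsRep F′ r₁) (r₁~a : C′ r₁ a)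
                 (r₂-rep : IsRep F′ r₂) (r₂~b : C′ r₂ b) (r₁<r₂ : toℕ r₁ < toℕ r₂)
                 (crossing′ : ∀ {x y} → Connected F x y → C′ x y ⊎ (C′ x a × C′ b y) ⊎ (C′ x b × C′ a y))
                 (a~b : Connected F a b) where
      r₂-¬rep : ¬ IsRep F r₂
      r₂-¬rep r₂-rep′ = <⇒≱ r₁<r₂ (r₂-rep′ r₁ (Connected-trans (Connected-mono F′⊆F r₂~b)
        (Connected-trans (Connected-sym a~b) (Connected-mono F′⊆F (Connected-sym r₁~a)))))

      new-rep : ∀ {w} → IsRep F′ w → IsRep F w ⊎ w ≡ r₂
      new-rep {w} w-rep′ with lem {IsRep F w}
      ... | yes w-rep = inj₁ w-rep
      ... | no ¬w-rep with ¬IsRep⇒smaller ¬w-rep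
      ... | z , w~z , z<w with crossing′ w~z
      ... | inj₁ w~′z = ⊥-elim (<⇒≱ z<w (w-rep′ z w~′z))
      ... | inj₂ (inj₁ (w~a , b~z)) =
        let w≡r₁ = IsRep-unique w-rep′ r₁-rep (Connected-trans w~a (Connected-sym r₁~a))
        in ⊥-elim (<⇒≱ (subst (λ r → toℕ z < toℕ r) w≡r₁ z<w)
                       (≤-trans (<⇒≤ r₁<r₂) (r₂-rep z (Connected-trans r₂~b b~z))))
      ... | inj₂ (inj₂ (w~b , _)) =
        inj₂ (IsRep-unique w-rep′ r₂-rep (Connected-trans w~b (Connected-sym r₂~b)))

      c-F′ : c F′ ≡ suc (c F)
      c-F′ = length-filterBy-extend (IsRep F) (IsRep F′) (allFin n) (allFin⁺ n) (∈-allFin r₂)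
               r₂-¬rep r₂-rep (IsRep-antimono F′⊆F) new-rep

    c-delete : c F′ ≡ suc (c F)
    c-delete with repOf F′ va | repOf F′ vb
    ... | ra , ra-rep , ra~a | rb , rb-rep , rb~b with <-cmp (toℕ ra) (toℕ rb)
    ... | tri< ra<rb _ _ = Count.c-F′ va vb ra rb ra-rep ra~a rb-rep rb~b ra<rb (crossing ∘ proj₂) a~b
    ... | tri> _ _ rb<ra = Count.c-F′ vb va rb ra rb-rep rb~b ra-rep ra~a rb<ra swapped (Connected-sym a~b)
      where
        swapped : ∀ {x y} → Connected F x y → C′ x y ⊎ (C′ x vb × C′ va y) ⊎ (C′ x va × C′ vb y)
        swapped x~y with crossing (proj₂ x~y)
        ... | inj₁ x~′y          = inj₁ x~′y
        ... | inj₂ (inj₁ through) = inj₂ (inj₂ through)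
        ... | inj₂ (inj₂ through) = inj₂ (inj₁ through)
    ... | tri≈ _ ra≡rb _ = ⊥-elim (separated
      (Connected-trans (Connected-sym ra~a) (subst (λ r → C′ r vb) (sym (toℕ-injective ra≡rb)) rb~b)))

  ∣F∣+c[F]≡n : ∀ {F} → SpanningForest F → ∣ F ∣ +ℕ c F ≡ n
  ∣F∣+c[F]≡n F-forest = go _ F-forest refl
    where
      go : ∀ k {F} → SpanningForest F → ∣ F ∣ ≡ k → ∣ F ∣ +ℕ c F ≡ n
      go k {F} F-forest ∣F∣≡k with nonempty? F
      ... | no F-empty rewrite Empty-unique F-empty = trans (cong (_+ℕ c ∅) (∣⊥∣≡0 m)) c-∅
      ... | yes (e , e∈F) with k | forestEdge-ordinary F-forest e∈F
      ... | zero  | _ = contradiction (trans (∣p∖x∣+1≡∣p∣ F e∈F) ∣F∣≡k) λ ()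
      ... | suc k | _ , _ , _ , e≡ = begin
        ∣ F ∣ +ℕ c F           ≡⟨ cong (_+ℕ c F) (∣p∖x∣+1≡∣p∣ F e∈F) ⟨
        suc ∣ F′ ∣ +ℕ c F      ≡⟨ +-suc ∣ F′ ∣ (c F) ⟨
        ∣ F′ ∣ +ℕ suc (c F)    ≡⟨ cong (∣ F′ ∣ +ℕ_) c-delete ⟨
        ∣ F′ ∣ +ℕ c F′         ≡⟨ go k (SpanningForest-antimono F′⊆F F-forest)
                                     (suc-injective (trans (∣p∖x∣+1≡∣p∣ F e∈F) ∣F∣≡k)) ⟩
        n                     ∎
        where
          open DeleteForestEdge F-forest e∈F e≡
          open ≡-Reasoning

  b≡c⇒balanced : ∀ {S} → b S ≡ c S → (∀ e a → e ∈ S → edge e ≢ half a) × Balanced S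
  b≡c⇒balanced {S} b≡c = (λ e a e∈S e≡ → let r , r∈ , r~a = rep a in proj₁ (balancedComp r∈) e a e∈S e≡ r~a)
                       , (λ v g p circ → let r , r∈ , r~v = rep v in proj₂ (balancedComp r∈) v g p circ r~v)
    where
      balancedComp : ∀ {r} → r ∈ₗ reps S → BalancedComp S r
      balancedComp = length-filterBy≡length⇒P (BalancedComp S) (reps S) b≡c
      rep : ∀ v → Σ (Fin n) λ r → r ∈ₗ reps S × Connected S r v
      rep v = let r , r-rep , r~v = repOf S v
              in r , ∈-filter⁺ (λ r → lem {IsRep S r}) (∈-allFin r) r-rep , r~v

  -- Edge sets sandwiched between a forest and its externally active edges

  module Sandwiching (_<O_ : Fin m → Fin m → Set) {F S : Subset m} (F-forest : SpanningForest F)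
                     (F≤S≤F+EA : Sandwiched F (ExternallyActive _<O_ F) S) where

    F⊆S : F ⊆ S
    F⊆S = proj₁ F≤S≤F+EA

    F-balanced : Balanced F
    F-balanced = SpanningForest⇒Balanced F-forest

    parallelWalk : ∀ {e} → e ∈ S → ParallelWalk F e
    parallelWalk e∈S with proj₂ F≤S≤F+EA e∈S
    ... | inj₂ (_ , _ , C , _) = balancedCircle⇒ParallelWalk F-forest C
    ... | inj₁ e∈F =
      let a , b , g₀ , e≡ = forestEdge-ordinary F-forest e∈F
      in inj₂ (a , b , g₀ , e≡ , subst (Walk F a b) (identityʳ g₀) (fwd _ e∈F e≡ []))

    stepInForest : ∀ {e a b g₀} → e ∈ S → edge e ≡ ordinary a b g₀ → Walk F a b g₀
    stepInForest e∈S e≡ with parallelWalk e∈S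
    ... | inj₁ e≡loose = contradiction (trans (sym e≡) e≡loose) λ ()
    ... | inj₂ (_ , _ , _ , e≡′ , w) with ordinary-injective (trans (sym e≡) e≡′)
    ... | refl , refl , refl = w

    toForestWalk : ∀ {x y g} → Walk S x y g → Walk F x y g
    toForestWalk []               = []
    toForestWalk (fwd _ e∈S e≡ p) = stepInForest e∈S e≡ ++ʷ toForestWalk p
    toForestWalk (bwd _ e∈S e≡ p) = reverse (stepInForest e∈S e≡) ++ʷ toForestWalk p

    S-balanced : Balanced S
    S-balanced _ _ p _ = closedWalk-gain F-balanced (toForestWalk p)

    S-no-half : ∀ e a → e ∈ S → edge e ≢ half a
    S-no-half e a e∈S e≡ with parallelWalk e∈S
    ... | inj₁ e≡loose               = contradiction (trans (sym e≡) e≡loose) λ ()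
    ... | inj₂ (_ , _ , _ , e≡′ , _) = contradiction (trans (sym e≡) e≡′) λ ()

    Connected-S⇒F : ∀ {x y} → Connected S x y → Connected F x y
    Connected-S⇒F (_ , p) = _ , toForestWalk p

    reps-≡ : reps S ≡ reps F
    reps-≡ = filterBy-cong (allFin n) (λ _ r-rep → IsRep-antimono F⊆S r-rep)
                                      (λ _ r-rep w r~w → r-rep w (Connected-S⇒F r~w))

    balancedReps-≡ : balancedReps S ≡ reps F
    balancedReps-≡ = trans (filter-all (λ r → lem {BalancedComp S r}) (All.tabulate (λ _ → balanced))) reps-≡
      where
        balanced : ∀ {r} → BalancedComp S r
        balanced = (λ e a e∈S e≡ _ → S-no-half e a e∈S e≡) , (λ v g p circ _ → S-balanced v g p circ)

    pathGain-≡ : ∀ v w → pathGain S v w ≡ pathGain F v w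
    pathGain-≡ v w with lem {Σ G λ g → Σ (Walk S v w g) IsPath} | lem {Σ G λ g → Σ (Walk F v w g) IsPath}
    ... | yes (_ , p , _) | yes (_ , q , _)      = cong just (walk-gain-unique S-balanced p (walk-mono F⊆S q))
    ... | no _            | no _                 = refl
    ... | no ∄p           | yes (_ , q , q-path) =
      ⊥-elim (∄p (_ , walk-mono F⊆S q , IsPath-transport q _ q-path))
    ... | yes (_ , p , _) | no ∄q                = ⊥-elim (∄q (_ , toPath F-balanced (toForestWalk p)))

    h/-≡ : ∀ r → h/ S r ≡ h/ F r
    h/-≡ r = cong (λ xs → fromMaybe (h r) (foldM _+ʷ_ xs)) (trans
      (cong (map (λ v → just (h v ·ʷ η S v)))
            (filterBy-cong (allFin n) (λ _ → Connected-S⇒F) (λ _ → Connected-mono F⊆S)))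
      (map-cong (λ v → cong (λ g → just (h v ·ʷ g)) (η-≡ v)) _))
      where
        open WeightSemigroup 𝔚 using () renaming (_+_ to _+ʷ_; _·_ to _·ʷ_)
        η-≡ : ∀ v → η S v ≡ η F v
        η-≡ v = cong (λ gs → fromMaybe ε (foldM _∨_ gs)) (map-cong (pathGain-≡ v) (allFin n))

    c≡b : c S ≡ b S
    c≡b = cong length (trans reps-≡ (sym balancedReps-≡))

    exponent-≡ : ∣ S ∣ ∸ ∣ F ∣ ≡ (∣ S ∣ +ℕ b S) ∸ n
    exponent-≡ = begin
      ∣ S ∣ ∸ ∣ F ∣                      ≡⟨ [m+n]∸[m+o]≡n∸o (c F) ∣ S ∣ ∣ F ∣ ⟨
      (c F +ℕ ∣ S ∣) ∸ (c F +ℕ ∣ F ∣)    ≡⟨ cong₂ _∸_ (ℕₚ.+-comm (c F) ∣ S ∣)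
                                                      (trans (ℕₚ.+-comm (c F) ∣ F ∣) (∣F∣+c[F]≡n F-forest)) ⟩
      (∣ S ∣ +ℕ c F) ∸ n                  ≡⟨ cong (λ k → (∣ S ∣ +ℕ length k) ∸ n) balancedReps-≡ ⟨
      (∣ S ∣ +ℕ b S) ∸ n                  ∎
      where open ≡-Reasoning

  module ForestOfSandwich (_<O_ : Fin m → Fin m → Set) (O-order : IsStrictTotalOrder _≡_ _<O_) where
    open IsStrictTotalOrder O-order using (isStrictPartialOrder; compare)
      renaming (irrefl to <O-irrefl; trans to <O-trans)

    Sandwich : Subset m → Subset m → Set
    Sandwich F S = Sandwiched F (ExternallyActive _<O_ F) S

    <O-wellFounded : WellFounded _<O_
    <O-wellFounded = spo-wellFounded isStrictPartialOrder

    >O-wellFounded : WellFounded (flip _<O_)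
    >O-wellFounded = spo-wellFounded (Flip.isStrictPartialOrder isStrictPartialOrder)

    ≮O⇒≥O : ∀ {x y} → ¬ x <O y → y ≡ x ⊎ y <O x
    ≮O⇒≥O {x} {y} x≮y with compare x y
    ... | tri< x<y _ _ = contradiction x<y x≮y
    ... | tri≈ _ x≡y _ = inj₁ (sym x≡y)
    ... | tri> _ _ y<x = inj₂ y<x

    <O-irrefl′ : ∀ {e} → ¬ e <O e
    <O-irrefl′ = <O-irrefl refl

    lowestDifference : ∀ {S F₁ F₂ e} → SpanningForest F₁ → F₁ ⊆ S → Sandwich F₂ S → e ∈ F₁ →
                       (∀ {f} → f <O e → f ∈ F₂ → f ∈ F₁) → e ∈ F₂
    lowestDifference {F₁ = F₁} {e = e} (_ , acyclic) F₁⊆S (_ , S⊆F₂+EA) e∈F₁ below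
      with S⊆F₂+EA (F₁⊆S e∈F₁)
    ... | inj₁ e∈F₂ = e∈F₂
    ... | inj₂ (_ , es , C , below-e) = ⊥-elim (acyclic es ε (circle-transport C ⊆F₁))
      where
        ⊆F₁ : ∀ {f} → f ∈ₗ es → f ∈ F₁
        ⊆F₁ {f} f∈ with below-e f f∈ | x∈p∪⁅y⁆⁻ (∈-circle C f∈)
        ... | inj₁ refl | _          = e∈F₁
        ... | inj₂ f<e  | inj₁ f∈F₂  = below f<e f∈F₂
        ... | inj₂ f<e  | inj₂ refl  = contradiction f<e <O-irrefl′

    sandwichedForest-unique : ∀ {S F₁ F₂} → SpanningForest F₁ → SpanningForest F₂ →
                              Sandwich F₁ S → Sandwich F₂ S → F₁ ≡ F₂
    sandwichedForest-unique {S} {F₁} {F₂} F₁-forest F₂-forest sw₁ sw₂ =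
      ⊆-antisym (λ {e} → proj₁ (agree e)) (λ {e} → proj₂ (agree e))
      where
        agree : ∀ e → (e ∈ F₁ → e ∈ F₂) × (e ∈ F₂ → e ∈ F₁)
        agree = WF.All.wfRec <O-wellFounded 0ℓ _ λ e IH →
          (λ e∈F₁ → lowestDifference F₁-forest (proj₁ sw₁) sw₂ e∈F₁ (λ f<e → proj₂ (IH f<e))) ,
          (λ e∈F₂ → lowestDifference F₂-forest (proj₁ sw₂) sw₁ e∈F₂ (λ f<e → proj₁ (IH f<e)))

    module Kruskal {S : Subset m} (S-no-half : ∀ e a → e ∈ S → edge e ≢ half a)
                   (S-balanced : Balanced S) where

      IsCircleMax : Fin m → Set
      IsCircleMax e = Σ G λ g → Σ (List (Fin m)) λ es →
                      Circle S es g × e ∈ₗ es × (∀ f → f ∈ₗ es → f ≡ e ⊎ f <O e)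

      K : Subset m
      K = toSubset (λ e → e ∈ S × ¬ IsCircleMax e)

      K-below S-below : Fin m → Subset m
      K-below e = toSubset (λ f → f ∈ K × f <O e)
      S-below e = toSubset (λ f → f ∈ S × f <O e)

      K⊆S : K ⊆ S
      K⊆S = proj₁ ∘ ∈-toSubset⁻ _

      K-below⊆K : ∀ {e} → K-below e ⊆ K
      K-below⊆K = proj₁ ∘ ∈-toSubset⁻ _

      K-below-mono : ∀ {f e} → f <O e → K-below f ⊆ K-below e
      K-below-mono f<e g∈ = let g∈K , g<f = ∈-toSubset⁻ _ g∈ in ∈-toSubset⁺ _ (g∈K , <O-trans g<f f<e)

      ∉K⇒IsCircleMax : ∀ {f} → f ∈ S → f ∉ K → IsCircleMax f
      ∉K⇒IsCircleMax {f} f∈S f∉K with lem {IsCircleMax f}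
      ... | yes max = max
      ... | no ¬max = contradiction (∈-toSubset⁺ _ (f∈S , ¬max)) f∉K

      circle-nonempty : ∀ {T es g} → Circle T es g → Σ (Fin m) (_∈ₗ es)
      circle-nonempty (walkCircle (fwd e _ _ _) _) = e , here refl
      circle-nonempty (walkCircle (bwd e _ _ _) _) = e , here refl
      circle-nonempty (walkCircle [] (nonempty , _)) = contradiction refl nonempty
      circle-nonempty (looseCircle e _ _) = e , here refl

      K-forest : SpanningForest K
      K-forest = (λ e a → S-no-half e a ∘ K⊆S) , acyclic
        where
          acyclic : ∀ es g → ¬ Circle K es g
          acyclic es g C =
            let f , f∈ = circle-nonempty C
                e , e∈ , e-max = minimal >O-wellFounded (_∈ₗ es) f∈
            in proj₂ (∈-toSubset⁻ _ (∈-circle C e∈))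
                     (g , es , circle-mono K⊆S C , e∈ , λ f f∈ → ≮O⇒≥O (e-max f∈))

      Bridged : Subset m → Fin m → Set
      Bridged T e = edge e ≡ loose ⊎
        (Σ (Fin n) λ a → Σ (Fin n) λ b → Σ G λ g₀ → edge e ≡ ordinary a b g₀ × Connected T a b)

      -- By induction along O: the rest of a circle with largest edge e consists of smaller edges of S,
      -- and each of them that is missing from K is in turn bridged by still smaller edges of K.
      circleMax⇒Bridged : ∀ e → IsCircleMax e → Bridged (K-below e) e
      circleMax⇒Bridged = WF.All.wfRec <O-wellFounded 0ℓ _ bridge
        where
          bridge : ∀ e → (∀ {f} → f <O e → IsCircleMax f → Bridged (K-below f) f) →
                   IsCircleMax e → Bridged (K-below e) e
          bridge e IH (_ , _ , looseCircle _ _ e≡loose , here refl , _) = inj₁ e≡loose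
          bridge e IH (_ , _ , walkCircle p (_ , unique-edges , _) , e∈p , below-e)
            with ∈-edges⇒ordinary p e∈p
          ... | a , b , g₀ , e≡ = inj₂ (a , b , g₀ , e≡ , bridged (cutAtEdge p unique-edges e∈p ⊆S-below e≡))
            where
              ⊆S-below : ∀ {f} → f ∈ₗ edges p → f ≢ e → f ∈ S-below e
              ⊆S-below {f} f∈ f≢e with below-e f f∈
              ... | inj₁ f≡e = contradiction f≡e f≢e
              ... | inj₂ f<e = ∈-toSubset⁺ _ (∈-edges p f∈ , f<e)

              step : ∀ {f x y g} → f ∈ S-below e → edge f ≡ ordinary x y g → Connected (K-below e) x y
              step {f} f∈ f≡ with ∈-toSubset⁻ _ f∈ | lem {f ∈ K}
              ... | _ , f<e | yes f∈K = _ , fwd f (∈-toSubset⁺ _ (f∈K , f<e)) f≡ []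
              ... | f∈S , f<e | no f∉K with IH f<e (∉K⇒IsCircleMax f∈S f∉K)
              ... | inj₁ f≡loose = contradiction (trans (sym f≡) f≡loose) λ ()
              ... | inj₂ (_ , _ , _ , f≡′ , x~y) with ordinary-injective (trans (sym f≡) f≡′)
              ... | refl , refl , refl = Connected-mono (K-below-mono f<e) x~y

              lower : ∀ {x y g} → Walk (S-below e) x y g → Connected (K-below e) x y
              lower []               = Connected-refl
              lower (fwd _ f∈ f≡ q) = Connected-trans (step f∈ f≡) (lower q)
              lower (bwd _ f∈ f≡ q) = Connected-trans (Connected-sym (step f∈ f≡)) (lower q)

              bridged : ∀ {v g} → EdgeCut (S-below e) v v g a b g₀ → Connected (K-below e) a b
              bridged (forwardCut α β _)  = Connected-sym (lower (β ++ʷ α))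
              bridged (backwardCut α β _) = lower (β ++ʷ α)

      CircleBelow : Subset m → Fin m → Set
      CircleBelow T e = Σ (List (Fin m)) λ es → Circle T es ε × (∀ f → f ∈ₗ es → f ≡ e ⊎ f <O e)

      e∈K∪⁅e⁆ : ∀ e → e ∈ K ∪ ⁅ e ⁆
      e∈K∪⁅e⁆ e = q⊆p∪q K ⁅ e ⁆ (x∈⁅x⁆ e)

      closingCircle : ∀ {e a b g₀ gα} → e ∈ S → edge e ≡ ordinary a b g₀ →
                      (α : Walk (K-below e) b a gα) → IsPath α → CircleBelow (K ∪ ⁅ e ⁆) e
      closingCircle {e} {a} {b} {g₀} {gα} e∈S e≡ α α-path =
        edges w , subst (Circle _ (edges w)) closing-gain (walkCircle w w-circle) , below-e
        where
          α⊆K∪e : ∀ {f} → f ∈ₗ edges α → f ∈ K ∪ ⁅ e ⁆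
          α⊆K∪e f∈ = p⊆p∪q ⁅ e ⁆ (K-below⊆K (∈-edges α f∈))

          α′ : Walk (K ∪ ⁅ e ⁆) b a gα
          α′ = transport α α⊆K∪e

          w : Walk (K ∪ ⁅ e ⁆) a a (g₀ ∙ gα)
          w = fwd e (e∈K∪⁅e⁆ e) e≡ α′

          α′-below : ∀ {f} → f ∈ₗ edges α′ → f ∈ K-below e
          α′-below {f} f∈ = ∈-edges α (subst (f ∈ₗ_) (edges-transport α α⊆K∪e) f∈)

          α′-path : IsPath α′
          α′-path = IsPath-transport α α⊆K∪e α-path

          w-circle : IsCircleWalk w
          w-circle = (λ ())
                   , ¬Any⇒All¬ _ (λ e∈ → <O-irrefl′ (proj₂ (∈-toSubset⁻ _ (α′-below e∈))))
                     ∷ IsPath⇒Unique-edges α′ α′-path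
                   , α′-path

          w⊆S : ∀ {f} → f ∈ₗ edges w → f ∈ S
          w⊆S f∈ with x∈p∪⁅y⁆⁻ (∈-edges w f∈)
          ... | inj₁ f∈K = K⊆S f∈K
          ... | inj₂ refl = e∈S

          closing-gain : g₀ ∙ gα ≡ ε
          closing-gain = S-balanced a _ (transport w w⊆S) (IsCircleWalk-transport w w⊆S w-circle)

          below-e : ∀ f → f ∈ₗ edges w → f ≡ e ⊎ f <O e
          below-e f (here refl) = inj₁ refl
          below-e f (there f∈)  = inj₂ (proj₂ (∈-toSubset⁻ _ (α′-below f∈)))

      bridged⇒CircleBelow : ∀ {e} → e ∈ S → Bridged (K-below e) e → CircleBelow (K ∪ ⁅ e ⁆) e
      bridged⇒CircleBelow {e} _ (inj₁ e≡loose) =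
        e ∷ [] , looseCircle e (e∈K∪⁅e⁆ e) e≡loose , λ { _ (here refl) → inj₁ refl }
      bridged⇒CircleBelow e∈S (inj₂ (_ , _ , _ , e≡ , a~b)) =
        let α , α-path = toPath (SpanningForest⇒Balanced (SpanningForest-antimono K-below⊆K K-forest))
                                (proj₂ (Connected-sym a~b))
        in closingCircle e∈S e≡ α α-path

      circleMax⇒ExternallyActive : ∀ {e} → e ∈ S → IsCircleMax e → ExternallyActive _<O_ K e
      circleMax⇒ExternallyActive {e} e∈S max =
        (λ e∈K → proj₂ (∈-toSubset⁻ _ e∈K) max) , bridged⇒CircleBelow e∈S (circleMax⇒Bridged e max)

      K-sandwich : Sandwich K S
      K-sandwich = K⊆S , sorted
        where
          sorted : ∀ {e} → e ∈ S → e ∈ K ⊎ ExternallyActive _<O_ K e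
          sorted {e} e∈S with lem {IsCircleMax e}
          ... | no ¬max = inj₁ (∈-toSubset⁺ _ (e∈S , ¬max))
          ... | yes max = inj₂ (circleMax⇒ExternallyActive e∈S max)

module Expansion (lem : ExcludedMiddle 0ℓ) {𝔊 : LatticeOrderedGroup} {𝔚 : WeightSemigroup 𝔊}
                 (ΦH : WeightedGainGraph 𝔊 𝔚) {ℓ₁ ℓ₂} (R : CommutativeRing ℓ₁ ℓ₂)
                 (u : WeightSemigroup.Carrier 𝔚 → CommutativeRing.Carrier R)
                 (y : CommutativeRing.Carrier R)
                 (_<O_ : Fin (WeightedGainGraph.m ΦH) → Fin (WeightedGainGraph.m ΦH) → Set)
                 (O-order : IsStrictTotalOrder _≡_ _<O_) where
  open WeightedGainGraph ΦH using (n; m)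
  open GainGraphNotions lem ΦH
  open GainGraphTheory lem ΦH using (b≡c⇒balanced; module Sandwiching; module ForestOfSandwich)
  open ForestOfSandwich _<O_ O-order
  open CommutativeRing R renaming (refl to ≈-refl; sym to ≈-sym; trans to ≈-trans)
  open Sums R
  open IntervalSum lem R (y - 1#)
  open import Relation.Binary.Reasoning.Setoid setoid

  x : Carrier
  x = y - 1#

  componentWeight : Subset m → Carrier
  componentWeight F = prodR R (map (λ W → u (h/ F W)) (reps F))

  dichromaticTerm : Subset m → Carrier
  dichromaticTerm S = pow R x ((∣ S ∣ +ℕ b S) ∸ n) * pow R 0# (c S ∸ b S) *
                      prodR R (map (λ W → u (h/ S W)) (balancedReps S))

  pairTerm : Subset m → Subset m → Carrier
  pairTerm F S =
    when (lem {SpanningForest F}) (when (lem {Sandwich F S}) (pow R x (∣ S ∣ ∸ ∣ F ∣)) * componentWeight F)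

  pow-cong : ∀ {a a′} k → a ≈ a′ → pow R a k ≈ pow R a′ k
  pow-cong zero    a≈a′ = ≈-refl
  pow-cong (suc k) a≈a′ = *-cong a≈a′ (pow-cong k a≈a′)

  1+x≈y : 1# + x ≈ y
  1+x≈y = begin
    1# + (y - 1#)     ≈⟨ +-congˡ (+-comm y (- 1#)) ⟩
    1# + (- 1# + y)   ≈⟨ +-assoc 1# (- 1#) y ⟨
    (1# - 1#) + y     ≈⟨ +-congʳ (-‿inverseʳ 1#) ⟩
    0# + y            ≈⟨ +-identityˡ y ⟩
    y                 ∎

  forestTerm-expand : ∀ F → when (lem {SpanningForest F}) (pow R y (εF _<O_ F) * componentWeight F) ≈
                            sumOver (allSubsets m) (pairTerm F)
  forestTerm-expand F = begin
    when F? (pow R y (εF _<O_ F) * componentWeight F)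
      ≈⟨ when-congʳ F? (*-congʳ (pow-cong (εF _<O_ F) 1+x≈y)) ⟨
    when F? (pow R (1# + x) (εF _<O_ F) * componentWeight F)
      ≈⟨ when-congʳ F? (*-congʳ (intervalSum m F (ExternallyActive _<O_ F) proj₁)) ⟨
    when F? (sumOver (allSubsets m) activeInterval * componentWeight F)
      ≈⟨ when-congʳ F? (sumOver-*ʳ (allSubsets m) _ _) ⟩
    when F? (sumOver (allSubsets m) (λ S → activeInterval S * componentWeight F))
      ≈⟨ when-sumOver F? (allSubsets m) _ ⟩
    sumOver (allSubsets m) (pairTerm F) ∎
    where
      F? : Dec (SpanningForest F)
      F? = lem
      activeInterval : Subset m → Carrier
      activeInterval = intervalTerm F (ExternallyActive _<O_ F)

  pairTerm-sandwich : ∀ {F S} → SpanningForest F → Sandwich F S → pairTerm F S ≈ dichromaticTerm S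
  pairTerm-sandwich {F} {S} F-forest sw = begin
    pairTerm F S
      ≈⟨ when-yes (lem {SpanningForest F}) F-forest _ ⟩
    when (lem {Sandwich F S}) (pow R x (∣ S ∣ ∸ ∣ F ∣)) * componentWeight F
      ≈⟨ *-congʳ (when-yes (lem {Sandwich F S}) sw _) ⟩
    pow R x (∣ S ∣ ∸ ∣ F ∣) * componentWeight F
      ≈⟨ *-congʳ (*-identityʳ _) ⟨
    pow R x (∣ S ∣ ∸ ∣ F ∣) * 1# * componentWeight F
      ≡⟨ cong₂ _*_ (cong₂ _*_ (cong (pow R x) (sym exponent-≡)) no-unbalanced) balanced-weight ⟨
    dichromaticTerm S ∎
    where
      open Sandwiching _<O_ F-forest sw
      no-unbalanced : pow R 0# (c S ∸ b S) ≡ 1#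
      no-unbalanced = cong (pow R 0#) (trans (cong (_∸ b S) c≡b) (n∸n≡0 (b S)))
      balanced-weight : prodR R (map (λ W → u (h/ S W)) (balancedReps S)) ≡ componentWeight F
      balanced-weight = cong (prodR R) (trans (cong (map (λ W → u (h/ S W))) balancedReps-≡)
                                                (map-cong (cong u ∘ h/-≡) (reps F)))

  pairTerm-vanish : ∀ {F S} → ¬ (SpanningForest F × Sandwich F S) → pairTerm F S ≈ 0#
  pairTerm-vanish {F} {S} ¬both with lem {SpanningForest F} | lem {Sandwich F S}
  ... | yes F-forest | yes sw = contradiction (F-forest , sw) ¬both
  ... | yes _        | no _   = zeroˡ (componentWeight F)
  ... | no _         | _      = ≈-refl

  dichromaticTerm-vanish : ∀ {S} → ¬ (Σ (Subset m) λ F → SpanningForest F × Sandwich F S) →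
                           dichromaticTerm S ≈ 0#
  dichromaticTerm-vanish {S} ∄F with c S ∸ b S in c∸b≡
  ... | zero = contradiction (K , K-forest , K-sandwich) ∄F
    where
      b≡c : b S ≡ c S
      b≡c = ≤-antisym (length-filter (λ r → lem {BalancedComp S r}) (reps S)) (m∸n≡0⇒m≤n c∸b≡)
      open Kruskal (proj₁ (b≡c⇒balanced b≡c)) (proj₂ (b≡c⇒balanced b≡c))
  ... | suc _ = ≈-trans (*-congʳ (≈-trans (*-congˡ (zeroˡ _)) (zeroʳ _))) (zeroˡ _)

  sumOver-pairTerm : ∀ S → sumOver (allSubsets m) (λ F → pairTerm F S) ≈ dichromaticTerm S
  sumOver-pairTerm S with lem {Σ (Subset m) λ F → SpanningForest F × Sandwich F S}
  ... | yes (F , F-forest , sw) =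
    ≈-trans (sumOver-allSubsets-single m F (λ F′ → pairTerm F′ S) λ F′ F′≢F →
               pairTerm-vanish λ (F′-forest , sw′) → F′≢F (sandwichedForest-unique F′-forest F-forest sw′ sw))
            (pairTerm-sandwich F-forest sw)
  ... | no ∄F =
    ≈-trans (sumOver-zero (allSubsets m) (λ _ → pairTerm-vanish λ (F-forest , sw) → ∄F (_ , F-forest , sw)))
            (≈-sym (dichromaticTerm-vanish ∄F))

  forestExpansion≈totalDichromatic : forestExpansion lem ΦH _<O_ R u y ≈ totalDichromatic lem ΦH R u x 0#
  forestExpansion≈totalDichromatic = begin
    sumOver (filterBy lem SpanningForest (allSubsets m)) (λ F → pow R y (εF _<O_ F) * componentWeight F)
      ≈⟨ sumOver-filterBy lem SpanningForest (allSubsets m) _ ⟩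
    sumOver (allSubsets m) (λ F → when (lem {SpanningForest F}) (pow R y (εF _<O_ F) * componentWeight F))
      ≈⟨ sumOver-cong (allSubsets m) (λ _ → forestTerm-expand _) ⟩
    sumOver (allSubsets m) (λ F → sumOver (allSubsets m) (pairTerm F))
      ≈⟨ sumOver-swap (allSubsets m) (allSubsets m) pairTerm ⟩
    sumOver (allSubsets m) (λ S → sumOver (allSubsets m) (λ F → pairTerm F S))
      ≈⟨ sumOver-cong (allSubsets m) (λ _ → sumOver-pairTerm _) ⟩
    sumOver (allSubsets m) dichromaticTerm ∎

theorem4p6 : (lem : ExcludedMiddle 0ℓ)
    {𝔊 : LatticeOrderedGroup} {𝔚 : WeightSemigroup 𝔊}
    (ΦH : WeightedGainGraph 𝔊 𝔚)
    {c ℓ : _} (R : CommutativeRing c ℓ)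
    (u : WeightSemigroup.Carrier 𝔚 → CommutativeRing.Carrier R)
    (y : CommutativeRing.Carrier R) →
    ((_<O_ _<O′_ : Fin (WeightedGainGraph.m ΦH) → Fin (WeightedGainGraph.m ΦH) → Set) →
      IsStrictTotalOrder _≡_ _<O_ → IsStrictTotalOrder _≡_ _<O′_ →
      CommutativeRing._≈_ R (forestExpansion lem ΦH _<O_ R u y)
                            (forestExpansion lem ΦH _<O′_ R u y))
    ×
    ((_<O_ : Fin (WeightedGainGraph.m ΦH) → Fin (WeightedGainGraph.m ΦH) → Set) →
      IsStrictTotalOrder _≡_ _<O_ →
      CommutativeRing._≈_ R (forestExpansion lem ΦH _<O_ R u y)
        (totalDichromatic lem ΦH R u
          (CommutativeRing._-_ R y (CommutativeRing.1# R)) (CommutativeRing.0# R)))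
theorem4p6 lem ΦH R u y = order-independent , expansion
  where
    open CommutativeRing R using (_≈_; _-_; 1#; 0#) renaming (trans to ≈-trans; sym to ≈-sym)

    expansion : ∀ _<O_ → IsStrictTotalOrder _≡_ _<O_ →
                forestExpansion lem ΦH _<O_ R u y ≈ totalDichromatic lem ΦH R u (y - 1#) 0#
    expansion = Expansion.forestExpansion≈totalDichromatic lem ΦH R u y

    order-independent : ∀ _<O_ _<O′_ → IsStrictTotalOrder _≡_ _<O_ → IsStrictTotalOrder _≡_ _<O′_ →
                        forestExpansion lem ΦH _<O_ R u y ≈ forestExpansion lem ΦH _<O′_ R u y
    order-independent _ _ O O′ = ≈-trans (expansion _ O) (≈-sym (expansion _ O′))
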